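{- Let $w$ be a permutation. The Hasse diagram of $\mathcal{P}(w)$ is a tree if and only if $w$ has no interval $I$ such that the subword of $w$ formed by the letters of $I$ is order-isomorphic to $p_1 \oplus p_2 \oplus p_3$ or to $p_1 \ominus p_2 \ominus p_3$ for some (nonempty) permutations $p_1, p_2, p_3$.
   Context: For $w \in \mathfrak{S}_n$ in one-line notation $w(1)\cdots w(n)$, an interval of $w$ is a set of consecutive integers $[h,h+j]$ with $\{w(t) : t \in [i,i+j]\} = [h,h+j]$ for some $i$; the interval poset $\mathcal{P}(w)$ is the set of nonempty intervals of $w$ ordered by inclusion. For $p \in \mathfrak{S}_a$, $q \in \mathfrak{S}_b$, the direct sum $p \oplus q \in \mathfrak{S}_{a+b}$ is $p(1)\cdots p(a)\,(q(1)+a)\cdots(q(b)+a)$ and the skew sum $p \ominus q$ is $(p(1)+b)\cdots(p(a)+b)\,q(1)\cdots q(b)$; both operations are associative. -}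

module Defs where

open import Data.Nat using (ℕ; zero; suc; _+_; _≤_; _<_; _≤?_)
open import Data.Fin using (Fin; toℕ; cast)
open import Data.Fin.Permutation using (Permutation′; _⟨$⟩ʳ_)
open import Data.List using (List; []; _∷_; _++_; map; length; allFin; filter; lookup)
open import Data.List.Relation.Unary.All using (All)
open import Data.List.Relation.Unary.Unique.Propositional using (Unique)
open import Data.Product using (Σ; ∃; _×_; _,_)
open import Data.Sum using (_⊎_)
open import Data.Unit using (⊤)
open import Data.Empty using (⊥)
open import Relation.Nullary using (¬_)
open import Relation.Nullary.Decidable using (_×-dec_)
open import Relation.Binary.PropositionalEquality using (_≡_; _≢_)
open import Function.Bundles using (_⇔_)

-- Permutations and one-line notation.
-- We use 0-based values: w ∈ 𝔖ₙ has one-line word w(0) ⋯ w(n-1) with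
-- values in {0,…,n-1}.  (Shifting by 1 changes nothing order-theoretic.)

val : ∀ {n} → Permutation′ n → Fin n → ℕ
val w t = toℕ (w ⟨$⟩ʳ t)

oneLine : ∀ {n} → Permutation′ n → List ℕ
oneLine w = map (val w) (allFin _)

_⊕_ : List ℕ → List ℕ → List ℕ
xs ⊕ ys = xs ++ map (_+ length xs) ys

_⊖_ : List ℕ → List ℕ → List ℕ
xs ⊖ ys = map (_+ length ys) xs ++ ys

infixl 6 _⊕_ _⊖_

OrderIso : List ℕ → List ℕ → Set
OrderIso xs ys =
  Σ (length xs ≡ length ys) λ eq →
    ∀ (s t : Fin (length xs)) →
      (lookup xs s < lookup xs t) ⇔ (lookup ys (cast eq s) < lookup ys (cast eq t))

-- Intervals.  The pair (h , j) stands for the set of integers [h, h+j].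
-- (h , j) is an interval of w if for some position i (with i+j < n)
-- { w(t) : t ∈ [i, i+j] } = [h, h+j].

IsInterval : ∀ {n} → Permutation′ n → ℕ × ℕ → Set
IsInterval {n} w (h , j) =
  Σ ℕ λ i → (i + j < n)
    × (∀ (t : Fin n) → i ≤ toℕ t → toℕ t ≤ i + j →
         h ≤ val w t × val w t ≤ h + j)
    × (∀ (v : ℕ) → h ≤ v → v ≤ h + j →
         Σ (Fin n) λ t → i ≤ toℕ t × toℕ t ≤ i + j × val w t ≡ v)

_⊆I_ : ℕ × ℕ → ℕ × ℕ → Set
(h , j) ⊆I (h' , j') = ∀ (x : ℕ) → h ≤ x → x ≤ h + j → h' ≤ x × x ≤ h' + j'

_⊂I_ : ℕ × ℕ → ℕ × ℕ → Set
I ⊂I J = I ⊆I J × I ≢ J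

Covers : ∀ {n} → Permutation′ n → ℕ × ℕ → ℕ × ℕ → Set
Covers w I J =
  I ⊂I J × ¬ (Σ (ℕ × ℕ) λ K → IsInterval w K × I ⊂I K × K ⊂I J)

HasseEdge : ∀ {n} → Permutation′ n → ℕ × ℕ → ℕ × ℕ → Set
HasseEdge w I J = IsInterval w I × IsInterval w J × (Covers w I J ⊎ Covers w J I)

Chain : ∀ {A : Set} → (A → A → Set) → List A → Set
Chain E []           = ⊤
Chain E (x ∷ [])     = ⊤
Chain E (x ∷ y ∷ zs) = E x y × Chain E (y ∷ zs)

lastOf : ∀ {A : Set} → A → List A → A
lastOf x []       = x
lastOf x (y ∷ ys) = lastOf y ys

Connected : ∀ {A : Set} → (A → Set) → (A → A → Set) → Set
Connected {A} V E =
  ∀ (x y : A) → V x → V y →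
    Σ (List A) λ l → All V l × Chain E (x ∷ l) × lastOf x l ≡ y

Acyclic : ∀ {A : Set} → (A → Set) → (A → A → Set) → Set
Acyclic {A} V E =
  ¬ (Σ A λ v₀ → Σ A λ v₁ → Σ A λ v₂ → Σ (List A) λ rest →
       All V (v₀ ∷ v₁ ∷ v₂ ∷ rest)
     × Unique (v₀ ∷ v₁ ∷ v₂ ∷ rest)
     × Chain E (v₀ ∷ v₁ ∷ v₂ ∷ rest)
     × E (lastOf v₂ rest) v₀)

IsTree : ∀ {A : Set} → (A → Set) → (A → A → Set) → Set
IsTree V E = Connected V E × Acyclic V E

HasseIsTree : ∀ {n} → Permutation′ n → Set
HasseIsTree w = IsTree (IsInterval w) (HasseEdge w)

subword : ∀ {n} → Permutation′ n → ℕ × ℕ → List ℕ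
subword w (h , j) = filter (λ x → (h ≤? x) ×-dec (x ≤? h + j)) (oneLine w)

module Submission where

-- An interval of w occurs as a block: consecutive positions carrying consecutive values.  Two
-- blocks sharing a position are either nested or overlap properly, as X = A·B and Y = B·C with
-- A, B, C nonempty.  A proper overlap is the same thing as the pattern: its union A·B·C is a
-- block in which A, B, C are blocks with increasing or with decreasing values, i.e. an
-- interval order-isomorphic to p₁ ⊕ p₂ ⊕ p₃ or to p₁ ⊖ p₂ ⊖ p₃.
--
-- Without the pattern, intervals sharing a position are nested, so every interval has at most
-- one upper cover; in such a Hasse diagram a non-backtracking walk that steps down once keeps
-- stepping down, so there is no cycle, and every interval is joined to [0, n-1] by a chain of
-- covers.
--
-- With the pattern, take a proper overlap X = A·B, Y = B·C with |A| + |C| minimal; B = X ∩ Y and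
-- U = X ∪ Y are intervals.  An interval strictly between B and X, B and Y, X and U or Y and U
-- would give a proper overlap with a shorter A or C, so B, X, U, Y is a 4-cycle of covers.

open import Data.Empty using (⊥; ⊥-elim)
open import Data.Fin as Fin using (Fin; toℕ; fromℕ<; punchOut; cast)
open import Data.Fin.Permutation using (Permutation′; _⟨$⟩ʳ_; _⟨$⟩ˡ_; inverseˡ)
open import Data.Fin.Properties
  using (toℕ<n; toℕ-fromℕ<; toℕ-injective; toℕ-cast; any?; injective⇒≤; punchOut-injective)
open import Data.List using (List; []; _∷_; _++_; map; length; lookup; applyUpTo; tabulate; allFin; filter)
open import Data.List.Properties
  using ( filter-++; filter-all; filter-none; ++-identityʳ; length-++; length-map; map-tabulate
        ; length-tabulate; tabulate-cong; length-applyUpTo; lookup-applyUpTo; map-applyUpTo)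
open import Data.List.Relation.Unary.All as All using (All; []; _∷_)
import Data.List.Relation.Unary.All.Properties as All
open import Data.List.Relation.Unary.AllPairs using (AllPairs; []; _∷_)
open import Data.Nat
open import Data.Nat.Induction using (<-wellFounded)
open import Data.Nat.Properties
open import Data.Nat.Tactic.RingSolver using (solve-∀)
open import Data.Product using (Σ; ∃; _×_; _,_; proj₁; proj₂; uncurry; map₁; map₂)
open import Data.Product.Properties using (≡-dec)
open import Data.Sum as Sum using (_⊎_; inj₁; inj₂)
open import Data.Unit using (⊤; tt)
open import Function using (id; _∘_; flip; _⇔_; mk⇔; Equivalence; mk⤖)
open import Function.Definitions using (Injective; Surjective)
open import Function.Properties.Bijection using (⤖⇒↔)
open import Induction.WellFounded using (Acc; acc)
open import Relation.Binary.Construct.Closure.ReflexiveTransitive as Star using (Star; ε; _◅_; _◅◅_)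
open import Relation.Binary.Definitions using (tri<; tri≈; tri>)
open import Relation.Binary.PropositionalEquality
open import Relation.Nullary using (¬_; ¬?; Dec; yes; no)
open import Relation.Nullary.Decidable using (_×-dec_; map′; toSum)

open import Defs

∸-<-⇔ : ∀ {h x y} → h ≤ x → h ≤ y → (x < y) ⇔ (x ∸ h < y ∸ h)
∸-<-⇔ {h} h≤x h≤y = mk⇔ (λ x<y → ∸-monoˡ-< x<y h≤x)
  (λ lt → subst₂ _<_ (m+[n∸m]≡n h≤x) (m+[n∸m]≡n h≤y) (+-monoʳ-< h lt))

∸-shift : ∀ {x} h d → h + d ≤ x → x ∸ (h + d) + d ≡ x ∸ h
∸-shift {x} h d h+d≤x = trans (cong (_+ d) (sym (∸-+-assoc x h d)))
  (m∸n+n≡m (m+n≤o⇒m≤o∸n d (subst (_≤ x) (+-comm h d) h+d≤x)))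

split-index : ∀ {s} α {β} → s < α + β → s < α ⊎ ∃ λ u → u < β × s ≡ α + u
split-index {s} α s<α+β with s <? α
... | yes s<α = inj₁ s<α
... | no  s≮α with u , refl ← m≤n⇒∃[o]m+o≡n (≮⇒≥ s≮α) =
  inj₂ (u , +-cancelˡ-< α _ _ s<α+β , refl)

<⇒∃+suc : ∀ {m n} → m < n → ∃ λ d → m + suc d ≡ n
<⇒∃+suc {m} m<n with d , m+1+d≡n ← m≤n⇒∃[o]m+o≡n m<n = d , trans (+-suc m d) m+1+d≡n

<+suc⇒≤ : ∀ {x} h k → x < h + suc k → x ≤ h + k
<+suc⇒≤ {x} h k x< = s≤s⁻¹ (subst (x <_) (+-suc h k) x<)

≤⇒<+suc : ∀ {x} h k → x ≤ h + k → x < h + suc k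
≤⇒<+suc {x} h k x≤ = subst (x <_) (sym (+-suc h k)) (s≤s x≤)

+suc-mono-< : ∀ {x k y m} → x + k < y + m → x + suc k < y + suc m
+suc-mono-< {x} {k} {y} {m} lt = subst₂ _<_ (sym (+-suc x k)) (sym (+-suc y m)) (s≤s lt)

+suc-mono-≤ : ∀ {x k y m} → x + k ≤ y + m → x + suc k ≤ y + suc m
+suc-mono-≤ {x} {k} {y} {m} le = subst₂ _≤_ (sym (+-suc x k)) (sym (+-suc y m)) (s≤s le)

injective⇒surjective : ∀ {m} {f : Fin m → Fin m} → Injective _≡_ _≡_ f → Surjective _≡_ _≡_ f
injective⇒surjective {suc m} {f} f-inj y with any? (λ x → f x Fin.≟ y)
... | yes (x , fx≡y) = x , λ { refl → fx≡y }
... | no ∄x = ⊥-elim (1+n≰n (injective⇒≤ g-injective))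
  where
  g : Fin (suc m) → Fin m
  g x = punchOut {i = y} (λ y≡fx → ∄x (x , sym y≡fx))
  g-injective : Injective _≡_ _≡_ g
  g-injective e = f-inj (punchOut-injective {i = y} _ _ e)

InjectiveOn : ℕ → (ℕ → ℕ) → Set
InjectiveOn m f = ∀ {s t} → s < m → t < m → f s ≡ f t → s ≡ t

MapsInto : (ℕ → ℕ) → ℕ → ℕ → ℕ → Set
MapsInto f m g N = ∀ {s} → s < m → g ≤ f s × f s < g + N

private
  module Offset {f : ℕ → ℕ} {m g N : ℕ} (into : MapsInto f m g N) (inj : InjectiveOn m f) where

    offset : Fin m → Fin N
    offset t = fromℕ< (subst (f (toℕ t) ∸ g <_) (m+n∸m≡n g N) (∸-monoˡ-< (proj₂ fₜ) (proj₁ fₜ)))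
      where
      fₜ : g ≤ f (toℕ t) × f (toℕ t) < g + N
      fₜ = into (toℕ<n t)

    toℕ-offset : ∀ t → g + toℕ (offset t) ≡ f (toℕ t)
    toℕ-offset t = trans (cong (g +_) (toℕ-fromℕ< _)) (m+[n∸m]≡n (proj₁ (into (toℕ<n t))))

    offset-injective : Injective _≡_ _≡_ offset
    offset-injective {s} {t} e = toℕ-injective (inj (toℕ<n s) (toℕ<n t)
      (trans (sym (toℕ-offset s)) (trans (cong (λ x → g + toℕ x) e) (toℕ-offset t))))

injectiveOn⇒≤ : ∀ {f m g N} → MapsInto f m g N → InjectiveOn m f → m ≤ N
injectiveOn⇒≤ into inj = injective⇒≤ offset-injective
  where open Offset into inj

injectiveOn⇒onto : ∀ {f m g} → MapsInto f m g m → InjectiveOn m f →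
                   ∀ {v} → g ≤ v → v < g + m → ∃ λ s → s < m × f s ≡ v
injectiveOn⇒onto {f} {m} {g} into inj {v} g≤v v<g+m = toℕ s , toℕ<n s , (begin
    f (toℕ s)                ≡⟨ toℕ-offset s ⟨
    g + toℕ (offset s)       ≡⟨ cong (λ x → g + toℕ x) offset-s≡y ⟩
    g + toℕ y                ≡⟨ cong (g +_) (toℕ-fromℕ< _) ⟩
    g + (v ∸ g)              ≡⟨ m+[n∸m]≡n g≤v ⟩
    v                        ∎)
  where
  open Offset into inj
  open ≡-Reasoning
  y : Fin m
  y = fromℕ< (subst (v ∸ g <_) (m+n∸m≡n g m) (∸-monoˡ-< v<g+m g≤v))
  s : Fin m
  s = proj₁ (injective⇒surjective offset-injective y)
  offset-s≡y : offset s ≡ y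
  offset-s≡y = proj₂ (injective⇒surjective offset-injective y) refl

injectiveOn-between⇒≤ : ∀ {f m g e} → g ≤ e → (∀ {s} → s < m → g ≤ f s × f s < e) →
                        InjectiveOn m f → g + m ≤ e
injectiveOn-between⇒≤ {f} {m} {g} {e} g≤e into inj = subst (g + m ≤_) (m+[n∸m]≡n g≤e)
  (+-monoʳ-≤ g (injectiveOn⇒≤ into′ inj))
  where
  into′ : MapsInto f m g (e ∸ g)
  into′ s<m = proj₁ (into s<m) , subst (_ <_) (sym (m+[n∸m]≡n g≤e)) (proj₂ (into s<m))

injectiveOn⇒permutation : ∀ {f m g} → MapsInto f m g m → InjectiveOn m f →
                          Σ (Permutation′ m) λ p → ∀ t → toℕ (p ⟨$⟩ʳ t) ≡ f (toℕ t) ∸ g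
injectiveOn⇒permutation into inj =
  ⤖⇒↔ (mk⤖ (offset-injective , injective⇒surjective offset-injective)) , λ t → toℕ-fromℕ< _
  where open Offset into inj

nth : List ℕ → ℕ → ℕ
nth []       _       = 0
nth (x ∷ xs) zero    = x
nth (x ∷ xs) (suc s) = nth xs s

nth-applyUpTo : ∀ f {m s} → s < m → nth (applyUpTo f m) s ≡ f s
nth-applyUpTo f {suc m} {zero}  _   = refl
nth-applyUpTo f {suc m} {suc s} s<m = nth-applyUpTo (f ∘ suc) (s<s⁻¹ s<m)

lookup≡nth : ∀ xs (i : Fin (length xs)) → lookup xs i ≡ nth xs (toℕ i)
lookup≡nth (x ∷ xs) Fin.zero    = refl
lookup≡nth (x ∷ xs) (Fin.suc i) = lookup≡nth xs i

nth-tabulate : ∀ {n} (f : Fin n → ℕ) i → nth (tabulate f) (toℕ i) ≡ f i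
nth-tabulate f Fin.zero    = refl
nth-tabulate f (Fin.suc i) = nth-tabulate (f ∘ Fin.suc) i

nth-++ˡ : ∀ xs ys {s} → s < length xs → nth (xs ++ ys) s ≡ nth xs s
nth-++ˡ (x ∷ xs) ys {zero}  _   = refl
nth-++ˡ (x ∷ xs) ys {suc s} s<n = nth-++ˡ xs ys (s<s⁻¹ s<n)

nth-++ʳ : ∀ xs ys u → nth (xs ++ ys) (length xs + u) ≡ nth ys u
nth-++ʳ []       ys u = refl
nth-++ʳ (x ∷ xs) ys u = nth-++ʳ xs ys u

nth-map : ∀ f xs {s} → s < length xs → nth (map f xs) s ≡ f (nth xs s)
nth-map f (x ∷ xs) {zero}  _   = refl
nth-map f (x ∷ xs) {suc s} s<n = nth-map f xs (s<s⁻¹ s<n)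

All-nth : ∀ {P : ℕ → Set} {xs s} → All P xs → s < length xs → P (nth xs s)
All-nth {s = zero}  (px ∷ _)   _   = px
All-nth {s = suc s} (_  ∷ pxs) s<n = All-nth pxs (s<s⁻¹ s<n)

applyUpTo-cong : ∀ {f g : ℕ → ℕ} m → (∀ {s} → s < m → f s ≡ g s) → applyUpTo f m ≡ applyUpTo g m
applyUpTo-cong zero    f≗g = refl
applyUpTo-cong (suc m) f≗g = cong₂ _∷_ (f≗g z<s) (applyUpTo-cong m (f≗g ∘ s<s))

applyUpTo-++ : ∀ (f : ℕ → ℕ) k m → applyUpTo f (k + m) ≡ applyUpTo f k ++ applyUpTo (λ u → f (k + u)) m
applyUpTo-++ f zero    m = refl
applyUpTo-++ f (suc k) m = cong (f 0 ∷_) (applyUpTo-++ (f ∘ suc) k m)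

tabulate-toℕ : ∀ {n} (f : ℕ → ℕ) → tabulate {n = n} (f ∘ toℕ) ≡ applyUpTo f n
tabulate-toℕ {zero}  f = refl
tabulate-toℕ {suc n} f = cong (f 0 ∷_) (tabulate-toℕ (f ∘ suc))

applyUpTo-⊕ : ∀ {f g F : ℕ → ℕ} k m → (∀ {s} → s < k → f s ≡ F s) →
              (∀ {u} → u < m → g u + k ≡ F (k + u)) →
              applyUpTo f k ⊕ applyUpTo g m ≡ applyUpTo F (k + m)
applyUpTo-⊕ {f} {g} {F} k m left right = begin
  applyUpTo f k ++ map (_+ length (applyUpTo f k)) (applyUpTo g m)
    ≡⟨ cong (λ l → applyUpTo f k ++ map (_+ l) (applyUpTo g m)) (length-applyUpTo f k) ⟩
  applyUpTo f k ++ map (_+ k) (applyUpTo g m)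
    ≡⟨ cong (applyUpTo f k ++_) (map-applyUpTo g (_+ k) m) ⟩
  applyUpTo f k ++ applyUpTo (λ u → g u + k) m
    ≡⟨ cong₂ _++_ (applyUpTo-cong k left) (applyUpTo-cong m right) ⟩
  applyUpTo F k ++ applyUpTo (λ u → F (k + u)) m
    ≡⟨ applyUpTo-++ F k m ⟨
  applyUpTo F (k + m) ∎
  where open ≡-Reasoning

applyUpTo-⊖ : ∀ {f g F : ℕ → ℕ} k m → (∀ {s} → s < k → f s + m ≡ F s) →
              (∀ {u} → u < m → g u ≡ F (k + u)) →
              applyUpTo f k ⊖ applyUpTo g m ≡ applyUpTo F (k + m)
applyUpTo-⊖ {f} {g} {F} k m left right = begin
  map (_+ length (applyUpTo g m)) (applyUpTo f k) ++ applyUpTo g m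
    ≡⟨ cong (λ l → map (_+ l) (applyUpTo f k) ++ applyUpTo g m) (length-applyUpTo g m) ⟩
  map (_+ m) (applyUpTo f k) ++ applyUpTo g m
    ≡⟨ cong (_++ applyUpTo g m) (map-applyUpTo f (_+ m) k) ⟩
  applyUpTo (λ s → f s + m) k ++ applyUpTo g m
    ≡⟨ cong₂ _++_ (applyUpTo-cong k left) (applyUpTo-cong m right) ⟩
  applyUpTo F k ++ applyUpTo (λ u → F (k + u)) m
    ≡⟨ applyUpTo-++ F k m ⟨
  applyUpTo F (k + m) ∎
  where open ≡-Reasoning

length-⊕ : ∀ xs ys → length (xs ⊕ ys) ≡ length xs + length ys
length-⊕ xs ys = trans (length-++ xs) (cong (length xs +_) (length-map _ ys))

length-⊖ : ∀ xs ys → length (xs ⊖ ys) ≡ length xs + length ys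
length-⊖ xs ys = trans (length-++ (map _ xs)) (cong (_+ length ys) (length-map _ xs))

⊕-bounded : ∀ {xs ys} → All (_< length xs) xs → All (_< length ys) ys →
            All (_< length (xs ⊕ ys)) (xs ⊕ ys)
⊕-bounded {xs} {ys} xs< ys< = subst (λ l → All (_< l) (xs ⊕ ys)) (sym (length-⊕ xs ys))
  (All.++⁺ (All.map (λ x< → <-≤-trans x< (m≤m+n _ _)) xs<)
           (All.map⁺ {P = _< length xs + length ys}
             (All.map (λ {y} y< → subst (y + length xs <_) (+-comm (length ys) (length xs))
                                         (+-monoˡ-< (length xs) y<)) ys<)))

⊕-cut : ∀ xs ys {s t} → All (_< length xs) xs → s < length xs → length xs ≤ t → t < length (xs ⊕ ys) →
        nth (xs ⊕ ys) s < nth (xs ⊕ ys) t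
⊕-cut xs ys {s} xs< s<xs xs≤t t<xs⊕ys with u , refl ← m≤n⇒∃[o]m+o≡n xs≤t = begin-strict
  nth (xs ⊕ ys) s                   ≡⟨ nth-++ˡ xs _ s<xs ⟩
  nth xs s                          <⟨ All-nth xs< s<xs ⟩
  length xs                         ≤⟨ All-nth (All.map⁺ {P = length xs ≤_} (All.universal (m≤n+m _) ys)) u<ys ⟩
  nth (map (_+ length xs) ys) u     ≡⟨ nth-++ʳ xs _ u ⟨
  nth (xs ⊕ ys) (length xs + u)     ∎
  where
  open ≤-Reasoning
  u<ys : u < length (map (_+ length xs) ys)
  u<ys = +-cancelˡ-< (length xs) _ _ (subst (_ <_) (length-++ xs) t<xs⊕ys)

⊖-cut : ∀ xs ys {s t} → All (_< length ys) ys → s < length xs → length xs ≤ t → t < length (xs ⊖ ys) →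
        nth (xs ⊖ ys) t < nth (xs ⊖ ys) s
⊖-cut xs ys {s} ys< s<xs xs≤t t<xs⊖ys with u , refl ← m≤n⇒∃[o]m+o≡n xs≤t = begin-strict
  nth (xs ⊖ ys) (length xs + u)     ≡⟨ cong (λ l → nth (xs ⊖ ys) (l + u)) (length-map _ xs) ⟨
  nth (xs ⊖ ys) (length xs′ + u)    ≡⟨ nth-++ʳ xs′ ys u ⟩
  nth ys u                          <⟨ All-nth ys< u<ys ⟩
  length ys                         ≤⟨ All-nth (All.map⁺ {P = length ys ≤_} (All.universal (m≤n+m _) xs)) s<xs′ ⟩
  nth xs′ s                         ≡⟨ nth-++ˡ xs′ ys s<xs′ ⟨
  nth (xs ⊖ ys) s                   ∎
  where
  open ≤-Reasoning
  xs′ : List ℕ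
  xs′ = map (_+ length ys) xs
  s<xs′ : s < length xs′
  s<xs′ = subst (s <_) (sym (length-map _ xs)) s<xs
  u<ys : u < length ys
  u<ys = +-cancelˡ-< (length xs) _ _ (subst (_ <_) (length-⊖ xs ys) t<xs⊖ys)

applyUpTo-orderIso : ∀ {f g : ℕ → ℕ} m → (∀ {s t} → s < m → t < m → (f s < f t) ⇔ (g s < g t)) →
                     OrderIso (applyUpTo f m) (applyUpTo g m)
applyUpTo-orderIso {f} {g} m f≅g = length≡ , λ s t →
  subst₂ _⇔_ (sym (cong₂ _<_ (at-f s) (at-f t))) (sym (cong₂ _<_ (at-g s) (at-g t))) (f≅g (bound s) (bound t))
  where
  length≡ : length (applyUpTo f m) ≡ length (applyUpTo g m)
  length≡ = trans (length-applyUpTo f m) (sym (length-applyUpTo g m))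
  bound : (s : Fin (length (applyUpTo f m))) → toℕ s < m
  bound s = subst (toℕ s <_) (length-applyUpTo f m) (toℕ<n s)
  at-f : ∀ s → lookup (applyUpTo f m) s ≡ f (toℕ s)
  at-f = lookup-applyUpTo f m
  at-g : ∀ s → lookup (applyUpTo g m) (cast length≡ s) ≡ g (toℕ s)
  at-g s = trans (lookup-applyUpTo g m _) (cong g (toℕ-cast length≡ s))

orderIso-reflects : ∀ {xs ys s t} → OrderIso xs ys → s < length xs → t < length xs →
                    nth ys s < nth ys t → nth xs s < nth xs t
orderIso-reflects {xs} {ys} (length≡ , iso) s<xs t<xs ys-s<t =
  subst₂ _<_ (at xs s<xs refl) (at xs t<xs refl)
    (Equivalence.from (iso (fromℕ< s<xs) (fromℕ< t<xs))
      (subst₂ _<_ (sym (at ys s<xs (toℕ-cast length≡ _))) (sym (at ys t<xs (toℕ-cast length≡ _))) ys-s<t))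
  where
  at : ∀ zs {u} (u<xs : u < length xs) {i : Fin (length zs)} → toℕ i ≡ toℕ (fromℕ< u<xs) →
       lookup zs i ≡ nth zs u
  at zs u<xs {i} i≡u = trans (lookup≡nth zs i) (cong (nth zs) (trans i≡u (toℕ-fromℕ< u<xs)))

oneLine-applyUpTo : ∀ {m} (p : Permutation′ m) {F : ℕ → ℕ} → (∀ t → val p t ≡ F (toℕ t)) →
                    oneLine p ≡ applyUpTo F m
oneLine-applyUpTo p {F} p≗F = trans (map-tabulate id (val p)) (trans (tabulate-cong p≗F) (tabulate-toℕ F))

length-oneLine : ∀ {m} (p : Permutation′ m) → length (oneLine p) ≡ m
length-oneLine {m} p = trans (length-map (val p) (allFin m)) (length-tabulate id)

oneLine-bounded : ∀ {m} (p : Permutation′ m) → All (_< m) (oneLine p)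
oneLine-bounded p = All.map⁺ (All.tabulate⁺ (λ t → toℕ<n (p ⟨$⟩ʳ t)))

-- The closed range [a, a+k] lies in [b, b+m]; used for values and for positions alike.
_⊑_ : ℕ × ℕ → ℕ × ℕ → Set
(a , k) ⊑ (b , m) = b ≤ a × a + k ≤ b + m

⊆I⇒⊑ : ∀ {I J} → I ⊆I J → I ⊑ J
⊆I⇒⊑ {h , k} I⊆J = proj₁ (I⊆J h ≤-refl (m≤m+n h k)) , proj₂ (I⊆J (h + k) (m≤m+n h k) ≤-refl)

⊑⇒⊆I : ∀ {I J} → I ⊑ J → I ⊆I J
⊑⇒⊆I (b≤a , a+k≤b+m) x a≤x x≤a+k = ≤-trans b≤a a≤x , ≤-trans x≤a+k a+k≤b+m

⊂I⇒proj₂< : ∀ {I J} → I ⊂I J → proj₂ I < proj₂ J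
⊂I⇒proj₂< {h , k} {g , m} (I⊆J , I≢J) with g≤h , h+k≤g+m ← ⊆I⇒⊑ I⊆J = ≤∧≢⇒< k≤m k≢m
  where
  k≤m : k ≤ m
  k≤m = +-cancelˡ-≤ g k m (≤-trans (+-monoˡ-≤ k g≤h) h+k≤g+m)
  k≢m : k ≢ m
  k≢m refl = I≢J (cong (_, k) (≤-antisym (+-cancelʳ-≤ k h g h+k≤g+m) g≤h))

⊂I? : ∀ I J → Dec (I ⊂I J)
⊂I? I@(h , k) J@(g , m) = map′ (map₁ ⊑⇒⊆I) (map₁ ⊆I⇒⊑)
  (((g ≤? h) ×-dec (h + k ≤? g + m)) ×-dec ¬? (≡-dec _≟_ _≟_ I J))

-- Hasse diagrams

module HasseDiagram {A : Set} (V : A → Set) (_⊏_ : A → A → Set) (rank : A → ℕ)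
                    (rank-mono : ∀ {x y} → x ⊏ y → rank x < rank y) where

  Between : A → A → Set
  Between x y = Σ A λ z → V z × x ⊏ z × z ⊏ y

  Cover : A → A → Set
  Cover x y = x ⊏ y × ¬ Between x y

  Edge : A → A → Set
  Edge x y = V x × V y × (Cover x y ⊎ Cover y x)

  Edge-sym : ∀ {x y} → Edge x y → Edge y x
  Edge-sym (vx , vy , c) = vy , vx , Sum.swap c

  walk⇒list : ∀ {x y} → Star Edge x y → Σ (List A) λ l → All V l × Chain Edge (x ∷ l) × lastOf x l ≡ y
  walk⇒list ε = [] , [] , tt , refl
  walk⇒list (e@(_ , vz , _) ◅ p) with l , vl , chain , last ← walk⇒list p =
    _ ∷ l , vz ∷ vl , (e , chain) , last

  module _ (between? : ∀ x y → Dec (Between x y)) where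

    cover-walk : ∀ N {x y} → V x → V y → x ⊏ y → rank y ≤ N + rank x → Star Edge x y
    cover-walk zero    vx vy x⊏y bound = ⊥-elim (<⇒≱ (rank-mono x⊏y) bound)
    cover-walk (suc N) {x} {y} vx vy x⊏y bound with between? x y
    ... | no ∄z = (vx , vy , inj₁ (x⊏y , ∄z)) ◅ ε
    ... | yes (z , vz , x⊏z , z⊏y) =
      cover-walk N vx vz x⊏z (s≤s⁻¹ (<-≤-trans (rank-mono z⊏y) bound)) ◅◅
      cover-walk N vz vy z⊏y
        (≤-trans bound (subst (_≤ N + rank z) (+-suc N (rank x)) (+-monoʳ-≤ N (rank-mono x⊏z))))

    connected : (top : A) → V top → (∀ {x} → V x → x ≡ top ⊎ x ⊏ top) → Connected V Edge
    connected top vtop below-top x y vx vy = walk⇒list (to-top vx ◅◅ Star.reverse Edge-sym (to-top vy))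
      where
      to-top : ∀ {x} → V x → Star Edge x top
      to-top vx with below-top vx
      ... | inj₁ refl = ε
      ... | inj₂ x⊏top = cover-walk (rank top) vx vtop x⊏top (m≤m+n _ _)

  Chain-++ : ∀ {R : A → A → Set} x l {y z} → Chain R (x ∷ l) → R (lastOf x l) y → R y z →
             Chain R (x ∷ l ++ y ∷ z ∷ [])
  Chain-++ x []      _             r₁ r₂ = r₁ , r₂ , tt
  Chain-++ x (y ∷ l) (r , chain) r₁ r₂ = r , Chain-++ y l chain r₁ r₂

  NonBacktracking : List A → Set
  NonBacktracking (x ∷ y ∷ z ∷ l) = x ≢ z × NonBacktracking (y ∷ z ∷ l)
  NonBacktracking _               = ⊤

  closed-nonBacktracking : ∀ {a b} zs {c d} → AllPairs _≢_ (a ∷ b ∷ zs) → All (c ≢_) (a ∷ b ∷ zs) →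
                           All (d ≢_) (b ∷ zs) → NonBacktracking (a ∷ b ∷ zs ++ c ∷ d ∷ [])
  closed-nonBacktracking []       _                       (c≢a ∷ _) (d≢b ∷ _) = c≢a ∘ sym , d≢b ∘ sym , tt
  closed-nonBacktracking (z ∷ zs) ((_ ∷ a≢z ∷ _) ∷ pairs) (_ ∷ c∉)  (_ ∷ d∉)  =
    a≢z , closed-nonBacktracking zs pairs c∉ d∉

  module _ (unique-cover : ∀ {x y z} → V x → V y → V z → Cover x y → Cover x z → y ≡ z) where

    descends : ∀ {x y} l → Chain Edge (x ∷ y ∷ l) → NonBacktracking (x ∷ y ∷ l) → Cover y x →
               Chain (flip Cover) (x ∷ y ∷ l)
    descends []      _                              _            y⋖x = y⋖x , tt
    descends (z ∷ l) ((vx , vy , _) , e@(_ , vz , c) , chain) (x≢z , nb) y⋖x with c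
    ... | inj₁ y⋖z = ⊥-elim (x≢z (unique-cover vy vx vz y⋖x y⋖z))
    ... | inj₂ z⋖y = y⋖x , descends l (e , chain) nb z⋖y

    EndsAscending : List A → Set
    EndsAscending (x ∷ y ∷ [])    = Cover x y
    EndsAscending (x ∷ y ∷ z ∷ l) = EndsAscending (y ∷ z ∷ l)
    EndsAscending _               = ⊥

    ¬descending∧endsAscending : ∀ l → Chain (flip Cover) l → EndsAscending l → ⊥
    ¬descending∧endsAscending (x ∷ y ∷ [])    (y⋖x , _)  x⋖y  =
      <-asym (rank-mono (proj₁ y⋖x)) (rank-mono (proj₁ x⋖y))
    ¬descending∧endsAscending (x ∷ y ∷ z ∷ l) (_ , down) ends =
      ¬descending∧endsAscending (y ∷ z ∷ l) down ends

    ascends : ∀ {x y} l → Chain Edge (x ∷ y ∷ l) → NonBacktracking (x ∷ y ∷ l) →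
              EndsAscending (x ∷ y ∷ l) → Chain Cover (x ∷ y ∷ l)
    ascends l chain@((_ , _ , inj₂ y⋖x) , _) nb ends =
      ⊥-elim (¬descending∧endsAscending _ (descends l chain nb y⋖x) ends)
    ascends []      ((_ , _ , inj₁ x⋖y) , _)     _        _    = x⋖y , tt
    ascends (z ∷ l) ((_ , _ , inj₁ x⋖y) , chain) (_ , nb) ends = x⋖y , ascends l chain nb ends

    ascending-rank : ∀ {x} l → Chain Cover (x ∷ l) → All (λ y → rank x < rank y) l
    ascending-rank []      _                = []
    ascending-rank (y ∷ l) (x⋖y , chain) =
      rank-mono (proj₁ x⋖y) ∷ All.map (<-trans (rank-mono (proj₁ x⋖y))) (ascending-rank l chain)

    descending-rank : ∀ {x} l → Chain (flip Cover) (x ∷ l) → All (λ y → rank y < rank x) l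
    descending-rank []      _                = []
    descending-rank (y ∷ l) (y⋖x , chain) =
      rank-mono (proj₁ y⋖x) ∷ All.map (λ r → <-trans r (rank-mono (proj₁ y⋖x))) (descending-rank l chain)

    endsAscending-++ : ∀ x l {c d} → Cover c d → EndsAscending (x ∷ l ++ c ∷ d ∷ [])
    endsAscending-++ x []          c⋖d = c⋖d
    endsAscending-++ x (y ∷ [])    c⋖d = c⋖d
    endsAscending-++ x (y ∷ z ∷ l) c⋖d = endsAscending-++ y (z ∷ l) c⋖d

    acyclic : Acyclic V Edge
    acyclic (v₀ , v₁ , v₂ , rest , _ , (v₀∉@(_ ∷ v₀≢v₂ ∷ _) ∷ unique@(v₁∉ ∷ _)) , chain , closing)
      =
      first-step (proj₂ (proj₂ (proj₁ chain)))
      where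
      T′ : List A
      T′ = v₂ ∷ rest ++ v₀ ∷ v₁ ∷ []
      T : List A
      T = v₁ ∷ T′
      walk : Chain Edge (v₀ ∷ T)
      walk = Chain-++ v₀ (v₁ ∷ v₂ ∷ rest) chain closing (proj₁ chain)
      no-backtrack : NonBacktracking (v₀ ∷ T)
      no-backtrack = v₀≢v₂ , closed-nonBacktracking rest unique v₀∉ v₁∉
      returns : ∀ {P : A → Set} → All P T → P v₀
      returns all with p ∷ _ ← All.++⁻ʳ (v₁ ∷ v₂ ∷ rest) all = p
      first-step : Cover v₀ v₁ ⊎ Cover v₁ v₀ → ⊥
      first-step (inj₁ v₀⋖v₁) = <-irrefl refl (returns (ascending-rank T
        (ascends T′ walk no-backtrack (endsAscending-++ v₀ (v₁ ∷ v₂ ∷ rest) v₀⋖v₁))))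
      first-step (inj₂ v₁⋖v₀) =
        <-irrefl refl (returns (descending-rank T (descends T′ walk no-backtrack v₁⋖v₀)))

-- Intervals of a permutation

module Intervals {n : ℕ} (w : Permutation′ n) where

  -- Nothing about W is used beyond W-val, so its definition is kept opaque.
  opaque
    W : ℕ → ℕ
    W = nth (oneLine w)

    W-val : ∀ t → W (toℕ t) ≡ val w t
    W-val t = trans (cong (λ l → nth l (toℕ t)) (map-tabulate id (val w))) (nth-tabulate (val w) t)

  W-fromℕ< : ∀ {s} (s<n : s < n) → W s ≡ val w (fromℕ< s<n)
  W-fromℕ< s<n = trans (cong W (sym (toℕ-fromℕ< s<n))) (W-val _)

  W<n : ∀ {s} → s < n → W s < n
  W<n s<n = subst (_< n) (sym (W-fromℕ< s<n)) (toℕ<n _)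

  W-injective : InjectiveOn n W
  W-injective s<n t<n Ws≡Wt = begin
    _                             ≡⟨ toℕ-fromℕ< s<n ⟨
    toℕ (fromℕ< s<n)              ≡⟨ cong toℕ (Inverse-injective (toℕ-injective
                                       (trans (sym (W-fromℕ< s<n)) (trans Ws≡Wt (W-fromℕ< t<n))))) ⟩
    toℕ (fromℕ< t<n)              ≡⟨ toℕ-fromℕ< t<n ⟩
    _                             ∎
    where
    open ≡-Reasoning
    Inverse-injective : ∀ {x y} → w ⟨$⟩ʳ x ≡ w ⟨$⟩ʳ y → x ≡ y
    Inverse-injective {x} {y} e = trans (sym (inverseˡ w)) (trans (cong (w ⟨$⟩ˡ_) e) (inverseˡ w))

  oneLine≡applyUpTo : oneLine w ≡ applyUpTo W n
  oneLine≡applyUpTo = oneLine-applyUpTo w (sym ∘ W-val)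

  -- The positions i, …, i+ℓ-1 carry the values h, …, h+ℓ-1.  Ranges are half-open here,
  -- whereas the pair (h , k) of IsInterval stands for the closed range [h, h+k].
  Block : ℕ → ℕ → ℕ → Set
  Block i ℓ h = i + ℓ ≤ n × MapsInto (λ s → W (i + s)) ℓ h ℓ

  module _ {i ℓ h : ℕ} (B : Block i ℓ h) where

    Block-injective : InjectiveOn ℓ (λ s → W (i + s))
    Block-injective s<ℓ t<ℓ = +-cancelˡ-≡ i _ _ ∘ W-injective (position<n s<ℓ) (position<n t<ℓ)
      where
      position<n : ∀ {s} → s < ℓ → i + s < n
      position<n s<ℓ = <-≤-trans (+-monoʳ-< i s<ℓ) (proj₁ B)

    Block-onto : ∀ {v} → h ≤ v → v < h + ℓ → ∃ λ s → s < ℓ × W (i + s) ≡ v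
    Block-onto = injectiveOn⇒onto (proj₂ B) Block-injective

    Block-value : ∀ {t} → i ≤ t → t < i + ℓ → h ≤ W t × W t < h + ℓ
    Block-value i≤t t<i+ℓ with s , refl ← m≤n⇒∃[o]m+o≡n i≤t = proj₂ B (+-cancelˡ-< i _ _ t<i+ℓ)

    Block-position : ∀ {t} → t < n → h ≤ W t → W t < h + ℓ → i ≤ t × t < i + ℓ
    Block-position {t} t<n h≤Wt Wt<h+ℓ = let s , s<ℓ , Wi+s≡Wt = Block-onto h≤Wt Wt<h+ℓ in
      subst (λ p → i ≤ p × p < i + ℓ) (W-injective (<-≤-trans (+-monoʳ-< i s<ℓ) (proj₁ B)) t<n Wi+s≡Wt)
        (m≤m+n i s , +-monoʳ-< i s<ℓ)

    Block-above : ∀ {t} → t < n → ¬ (i ≤ t × t < i + ℓ) → h ≤ W t → h + ℓ ≤ W t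
    Block-above t<n outside h≤Wt = ≮⇒≥ (outside ∘ Block-position t<n h≤Wt)

    Block-below : ∀ {t} → t < n → ¬ (i ≤ t × t < i + ℓ) → W t < h + ℓ → W t < h
    Block-below t<n outside Wt<h+ℓ = ≰⇒> (λ h≤Wt → outside (Block-position t<n h≤Wt Wt<h+ℓ))

  Block-⊕ : ∀ {i α β h} → Block i α h → Block (i + α) β (h + α) → Block i (α + β) h
  Block-⊕ {i} {α} {β} {h} A B = subst (_≤ n) (+-assoc i α β) (proj₁ B) , values
    where
    values : MapsInto (λ s → W (i + s)) (α + β) h (α + β)
    values s<α+β with split-index α s<α+β
    ... | inj₁ s<α = proj₁ (proj₂ A s<α) , <-≤-trans (proj₂ (proj₂ A s<α)) (+-monoʳ-≤ h (m≤m+n α β))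
    ... | inj₂ (u , u<β , refl) = subst (λ t → h ≤ W t × W t < h + (α + β)) (+-assoc i α u)
      (≤-trans (m≤m+n h α) (proj₁ (proj₂ B u<β)) ,
       subst (W (i + α + u) <_) (+-assoc h α β) (proj₂ (proj₂ B u<β)))

  Block-⊖ : ∀ {i α β h} → Block i α (h + β) → Block (i + α) β h → Block i (α + β) h
  Block-⊖ {i} {α} {β} {h} A B = subst (_≤ n) (+-assoc i α β) (proj₁ B) , values
    where
    values : MapsInto (λ s → W (i + s)) (α + β) h (α + β)
    values {s} s<α+β with split-index α s<α+β
    ... | inj₁ s<α = ≤-trans (m≤m+n h β) (proj₁ (proj₂ A s<α)) ,
      subst (W (i + s) <_) (trans (+-assoc h β α) (cong (h +_) (+-comm β α))) (proj₂ (proj₂ A s<α))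
    ... | inj₂ (u , u<β , refl) = subst (λ t → h ≤ W t × W t < h + (α + β)) (+-assoc i α u)
      (proj₁ (proj₂ B u<β) , <-≤-trans (proj₂ (proj₂ B u<β)) (+-monoʳ-≤ h (m≤n+m β α)))

  Block-⊕⁻ˡ : ∀ {i α β h} → Block i (α + β) h → Block (i + α) β (h + α) → Block i α h
  Block-⊕⁻ˡ {i} {α} {β} {h} AB B = ≤-trans (+-monoʳ-≤ i (m≤m+n α β)) (proj₁ AB) , values
    where
    values : MapsInto (λ s → W (i + s)) α h α
    values {s} s<α = proj₁ (proj₂ AB (<-≤-trans s<α (m≤m+n α β))) ,
      Block-below B (<-≤-trans (+-monoʳ-< i (<-≤-trans s<α (m≤m+n α β))) (proj₁ AB))
        (λ (i+α≤i+s , _) → <⇒≱ s<α (+-cancelˡ-≤ i α s i+α≤i+s))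
        (subst (W (i + s) <_) (sym (+-assoc h α β)) (proj₂ (proj₂ AB (<-≤-trans s<α (m≤m+n α β)))))

  Block-⊖⁻ʳ : ∀ {i α β h} → Block i (α + β) h → Block i α (h + β) → Block (i + α) β h
  Block-⊖⁻ʳ {i} {α} {β} {h} AB A = subst (_≤ n) (sym (+-assoc i α β)) (proj₁ AB) , values
    where
    values : MapsInto (λ u → W (i + α + u)) β h β
    values {u} u<β = subst (λ t → h ≤ W t × W t < h + β) (sym (+-assoc i α u))
      (proj₁ (proj₂ AB α+u<α+β) ,
       Block-below A (<-≤-trans (+-monoʳ-< i α+u<α+β) (proj₁ AB))
         (λ (_ , i+[α+u]<i+α) → <⇒≱ i+[α+u]<i+α (+-monoʳ-≤ i (m≤m+n α u)))
         (subst (W (i + (α + u)) <_) (trans (cong (h +_) (+-comm α β)) (sym (+-assoc h β α)))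
                (proj₂ (proj₂ AB α+u<α+β))))
      where
      α+u<α+β : α + u < α + β
      α+u<α+β = +-monoʳ-< α u<β

  private
    ⊑-mem : ∀ {a k b m x} → (a , k) ⊑ (b , m) → a ≤ x → x < a + suc k → b ≤ x × x < b + suc m
    ⊑-mem {a} {k} {b} {m} (b≤a , a+k≤b+m) a≤x x<a+1+k =
      ≤-trans b≤a a≤x , ≤⇒<+suc b m (≤-trans (<+suc⇒≤ a k x<a+1+k) a+k≤b+m)

    first∈ : ∀ a k → a ≤ a × a < a + suc k
    first∈ a k = ≤-refl , ≤⇒<+suc a k (m≤m+n a k)

    last∈ : ∀ a k → a ≤ a + k × a + k < a + suc k
    last∈ a k = m≤m+n a k , ≤⇒<+suc a k ≤-refl

  positions⊑⇒values⊑ : ∀ {i k h j m g} → Block i (suc k) h → Block j (suc m) g →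
                       (i , k) ⊑ (j , m) → (h , k) ⊑ (g , m)
  positions⊑⇒values⊑ {i} {k} {h} {j} {m} {g} I J i⊑j =
    proj₁ (value-at (proj₁ (first∈ h k)) (proj₂ (first∈ h k))) ,
    <+suc⇒≤ g m (proj₂ (value-at (proj₁ (last∈ h k)) (proj₂ (last∈ h k))))
    where
    value-at : ∀ {v} → h ≤ v → v < h + suc k → g ≤ v × v < g + suc m
    value-at h≤v v<h+1+k = let s , s<1+k , Wi+s≡v = Block-onto I h≤v v<h+1+k in
      subst (λ v → g ≤ v × v < g + suc m) Wi+s≡v
        (uncurry (Block-value J) (⊑-mem i⊑j (m≤m+n i s) (+-monoʳ-< i s<1+k)))

  values⊑⇒positions⊑ : ∀ {i k h j m g} → Block i (suc k) h → Block j (suc m) g →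
                       (h , k) ⊑ (g , m) → (i , k) ⊑ (j , m)
  values⊑⇒positions⊑ {i} {k} {h} {j} {m} {g} I J h⊑g =
    proj₁ (position-at (proj₁ (first∈ i k)) (proj₂ (first∈ i k))) ,
    <+suc⇒≤ j m (proj₂ (position-at (proj₁ (last∈ i k)) (proj₂ (last∈ i k))))
    where
    position-at : ∀ {t} → i ≤ t → t < i + suc k → j ≤ t × t < j + suc m
    position-at i≤t t<i+1+k = uncurry (Block-position J (<-≤-trans t<i+1+k (proj₁ I)))
      (uncurry (⊑-mem h⊑g) (Block-value I i≤t t<i+1+k))

  Block-values-unique : ∀ {i k h g} → Block i (suc k) h → Block i (suc k) g → h ≡ g
  Block-values-unique H G =
    ≤-antisym (proj₁ (positions⊑⇒values⊑ G H (≤-refl , ≤-refl))) (proj₁ (positions⊑⇒values⊑ H G (≤-refl , ≤-refl)))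

  Block-positions-unique : ∀ {i j k h} → Block i (suc k) h → Block j (suc k) h → i ≡ j
  Block-positions-unique I J =
    ≤-antisym (proj₁ (values⊑⇒positions⊑ J I (≤-refl , ≤-refl))) (proj₁ (values⊑⇒positions⊑ I J (≤-refl , ≤-refl)))

  same-positions⇒same-interval : ∀ {j k h j′ k′ h′} → Block j (suc k) h → Block j′ (suc k′) h′ →
                j ≡ j′ → j + suc k ≡ j′ + suc k′ → (h , k) ≡ (h′ , k′)
  same-positions⇒same-interval {j} {k} {h} {j′} {k′} {h′} K K′ j≡j′ ends≡ =
    cong₂ _,_ (Block-values-unique K (subst₂ (λ p q → Block p (suc q) h′) (sym j≡j′) (sym k≡k′) K′))
              k≡k′
    where
    k≡k′ : k ≡ k′
    k≡k′ = suc-injective (+-cancelˡ-≡ j _ _ (trans ends≡ (cong (_+ suc k′) (sym j≡j′))))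

  ⊆I⇒positions : ∀ {j k h j′ k′ h′} → Block j (suc k) h → Block j′ (suc k′) h′ →
           (h , k) ⊆I (h′ , k′) → j′ ≤ j × j + suc k ≤ j′ + suc k′
  ⊆I⇒positions K K′ K⊆K′ =
    let j′≤j , e≤e′ = values⊑⇒positions⊑ K K′ (⊆I⇒⊑ K⊆K′) in j′≤j , +suc-mono-≤ e≤e′

  positions⇒⊆I : ∀ {j k h j′ k′ h′} → Block j (suc k) h → Block j′ (suc k′) h′ →
              j′ ≤ j → j + suc k ≤ j′ + suc k′ → (h , k) ⊆I (h′ , k′)
  positions⇒⊆I {j} {k} {_} {j′} {k′} K K′ j′≤j e≤e′ =
    ⊑⇒⊆I (positions⊑⇒values⊑ K K′ (j′≤j , s≤s⁻¹ (subst₂ _≤_ (+-suc j k) (+-suc j′ k′) e≤e′)))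

  IsInterval⇒Block : ∀ {h k} → IsInterval w (h , k) → ∃ λ i → Block i (suc k) h
  IsInterval⇒Block {h} {k} (i , i+k<n , inside , _) = i , subst (_≤ n) (sym (+-suc i k)) i+k<n , values
    where
    values : MapsInto (λ s → W (i + s)) (suc k) h (suc k)
    values {s} s<1+k = subst (λ v → h ≤ v × v < h + suc k) (sym (W-fromℕ< i+s<n))
      (proj₁ bounds , ≤⇒<+suc h k (proj₂ bounds))
      where
      i+s≤i+k : i + s ≤ i + k
      i+s≤i+k = +-monoʳ-≤ i (s≤s⁻¹ s<1+k)
      i+s<n : i + s < n
      i+s<n = ≤-<-trans i+s≤i+k i+k<n
      bounds : h ≤ val w (fromℕ< i+s<n) × val w (fromℕ< i+s<n) ≤ h + k
      bounds = inside (fromℕ< i+s<n)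
        (subst (i ≤_) (sym (toℕ-fromℕ< i+s<n)) (m≤m+n i s))
        (subst (_≤ i + k) (sym (toℕ-fromℕ< i+s<n)) i+s≤i+k)

  Block⇒IsInterval : ∀ {i k h} → Block i (suc k) h → IsInterval w (h , k)
  Block⇒IsInterval {i} {k} {h} B = i , subst (_≤ n) (+-suc i k) (proj₁ B) , inside , onto
    where
    inside : ∀ t → i ≤ toℕ t → toℕ t ≤ i + k → h ≤ val w t × val w t ≤ h + k
    inside t i≤t t≤i+k = subst (λ v → h ≤ v × v ≤ h + k) (W-val t)
      (map₂ (<+suc⇒≤ h k) (Block-value B i≤t (≤⇒<+suc i k t≤i+k)))
    onto : ∀ v → h ≤ v → v ≤ h + k → Σ (Fin n) λ t → i ≤ toℕ t × toℕ t ≤ i + k × val w t ≡ v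
    onto v h≤v v≤h+k = let s , s<1+k , Wi+s≡v = Block-onto B h≤v (≤⇒<+suc h k v≤h+k)
                           i+s<n = <-≤-trans (+-monoʳ-< i s<1+k) (proj₁ B) in
      fromℕ< i+s<n ,
      subst (i ≤_) (sym (toℕ-fromℕ< i+s<n)) (m≤m+n i s) ,
      subst (_≤ i + k) (sym (toℕ-fromℕ< i+s<n)) (+-monoʳ-≤ i (s≤s⁻¹ s<1+k)) ,
      trans (sym (W-fromℕ< i+s<n)) Wi+s≡v

  Block? : ∀ i ℓ h → Dec (Block i ℓ h)
  Block? i ℓ h = (i + ℓ ≤? n) ×-dec allUpTo? (λ s → (h ≤? W (i + s)) ×-dec (W (i + s) <? h + ℓ)) ℓ

  IsInterval? : ∀ I → Dec (IsInterval w I)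
  IsInterval? (h , k) = map′
    (λ (i , _ , B) → Block⇒IsInterval B)
    (λ I → let i , B = IsInterval⇒Block I in i , <-≤-trans (m<m+n i z<s) (proj₁ B) , B)
    (anyUpTo? (λ i → Block? i (suc k) h) n)

  subword-Block : ∀ {i k h} → Block i (suc k) h → subword w (h , k) ≡ applyUpTo (λ s → W (i + s)) (suc k)
  subword-Block {i} {k} {h} B = begin
    filter P? (oneLine w)
      ≡⟨ cong (filter P?) (trans oneLine≡applyUpTo (cong (applyUpTo W) n≡i+[ℓ+r])) ⟩
    filter P? (applyUpTo W (i + (suc k + r)))
      ≡⟨ cong (filter P?) (trans (applyUpTo-++ W i (suc k + r))
                                 (cong (pre ++_) (applyUpTo-++ (λ s → W (i + s)) (suc k) r))) ⟩
    filter P? (pre ++ mid ++ post)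
      ≡⟨ filter-++ P? pre (mid ++ post) ⟩
    filter P? pre ++ filter P? (mid ++ post)
      ≡⟨ cong (filter P? pre ++_) (filter-++ P? mid post) ⟩
    filter P? pre ++ filter P? mid ++ filter P? post
      ≡⟨ cong₂ _++_ (filter-none P? pre-outside)
                    (cong₂ _++_ (filter-all P? mid-inside) (filter-none P? post-outside)) ⟩
    mid ++ []
      ≡⟨ ++-identityʳ mid ⟩
    mid ∎
    where
    open ≡-Reasoning
    P? : ∀ x → Dec (h ≤ x × x ≤ h + k)
    P? x = (h ≤? x) ×-dec (x ≤? h + k)
    r : ℕ
    r = n ∸ (i + suc k)
    n≡i+[ℓ+r] : n ≡ i + (suc k + r)
    n≡i+[ℓ+r] = trans (sym (m+[n∸m]≡n (proj₁ B))) (+-assoc i (suc k) r)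
    pre mid post : List ℕ
    pre = applyUpTo W i
    mid = applyUpTo (λ s → W (i + s)) (suc k)
    post = applyUpTo (λ u → W (i + (suc k + u))) r
    pre-outside : All (λ x → ¬ (h ≤ x × x ≤ h + k)) pre
    pre-outside = All.applyUpTo⁺₁ W i λ {s} s<i (h≤Ws , Ws≤h+k) →
      <⇒≱ s<i (proj₁ (Block-position B (<-≤-trans s<i (≤-trans (m≤m+n i _) (proj₁ B)))
                                       h≤Ws (≤⇒<+suc h k Ws≤h+k)))
    mid-inside : All (λ x → h ≤ x × x ≤ h + k) mid
    mid-inside = All.applyUpTo⁺₁ (λ s → W (i + s)) (suc k) λ s<ℓ → map₂ (<+suc⇒≤ h k) (proj₂ B s<ℓ)
    post-outside : All (λ x → ¬ (h ≤ x × x ≤ h + k)) post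
    post-outside = All.applyUpTo⁺₁ (λ u → W (i + (suc k + u))) r λ {u} u<r (h≤W , W≤h+k) →
      <⇒≱ (proj₂ (Block-position B
                    (subst (i + (suc k + u) <_) (sym n≡i+[ℓ+r]) (+-monoʳ-< i (+-monoʳ-< (suc k) u<r)))
                     h≤W (≤⇒<+suc h k W≤h+k)))
          (+-monoʳ-≤ i (m≤m+n (suc k) u))

  standardized : ℕ → ℕ → ℕ → List ℕ
  standardized i h ℓ = applyUpTo (λ s → W (i + s) ∸ h) ℓ

  standardize : ∀ {i ℓ h} → Block i ℓ h → Σ (Permutation′ ℓ) λ p → oneLine p ≡ standardized i h ℓ
  standardize B with p , p≗ ← injectiveOn⇒permutation (proj₂ B) (Block-injective B) = p , oneLine-applyUpTo p p≗

  Ascent : ℕ → ℕ → ℕ → Set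
  Ascent i α β = ∀ {s t} → s < α → α ≤ t → t < α + β → W (i + s) < W (i + t)

  Descent : ℕ → ℕ → ℕ → Set
  Descent i α β = ∀ {s t} → s < α → α ≤ t → t < α + β → W (i + t) < W (i + s)

  Block-suffix-above : ∀ {j β γ h} → Block j (β + γ) h → (∀ {u} → u < γ → h + β ≤ W (j + (β + u))) →
                 Block (j + β) γ (h + β)
  Block-suffix-above {j} {β} {γ} {h} BC lower = subst (_≤ n) (sym (+-assoc j β γ)) (proj₁ BC) , values
    where
    values : MapsInto (λ u → W (j + β + u)) γ (h + β) γ
    values {u} u<γ = subst (λ t → h + β ≤ W t × W t < h + β + γ) (sym (+-assoc j β u))
      (lower u<γ , subst (W (j + (β + u)) <_) (sym (+-assoc h β γ)) (proj₂ (proj₂ BC (+-monoʳ-< β u<γ))))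

  Block-prefix-above : ∀ {j α β h} → Block j (α + β) h → (∀ {s} → s < α → h + β ≤ W (j + s)) →
                       Block j α (h + β)
  Block-prefix-above {j} {α} {β} {h} AB lower = ≤-trans (+-monoʳ-≤ j (m≤m+n α β)) (proj₁ AB) , values
    where
    values : MapsInto (λ s → W (j + s)) α (h + β) α
    values {s} s<α = lower s<α , subst (W (j + s) <_) (trans (cong (h +_) (+-comm α β)) (sym (+-assoc h β α)))
      (proj₂ (proj₂ AB (<-≤-trans s<α (m≤m+n α β))))

  Block-split⊕ : ∀ {i α β h} → Block i (α + β) h → Ascent i α β →
                 Block i α h × Block (i + α) β (h + α)
  Block-split⊕ {i} {α} {β} {h} AB ascent = Block-⊕⁻ˡ AB B , B
    where
    B : Block (i + α) β (h + α)
    B = Block-suffix-above AB λ {u} u<β → injectiveOn-between⇒≤ (proj₁ (proj₂ AB (+-monoʳ-< α u<β)))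
      (λ s<α → proj₁ (proj₂ AB (<-≤-trans s<α (m≤m+n α β))) ,
               ascent s<α (m≤m+n α u) (+-monoʳ-< α u<β))
      (λ s<α t<α → Block-injective AB (<-≤-trans s<α (m≤m+n α β)) (<-≤-trans t<α (m≤m+n α β)))

  Block-split⊖ : ∀ {i α β h} → Block i (α + β) h → Descent i α β →
                 Block i α (h + β) × Block (i + α) β h
  Block-split⊖ {i} {α} {β} {h} AB descent = A , Block-⊖⁻ʳ AB A
    where
    A : Block i α (h + β)
    A = Block-prefix-above AB λ {s} s<α →
      injectiveOn-between⇒≤ (proj₁ (proj₂ AB (<-≤-trans s<α (m≤m+n α β))))
      (λ u<β → proj₁ (proj₂ AB (+-monoʳ-< α u<β)) , descent s<α (m≤m+n α _) (+-monoʳ-< α u<β))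
      (λ u<β v<β → +-cancelˡ-≡ α _ _ ∘ Block-injective AB (+-monoʳ-< α u<β) (+-monoʳ-< α v<β))

  DirectSum : ℕ → ℕ → ℕ → ℕ → ℕ → Set
  DirectSum i α β γ h = Block i α h × Block (i + α) β (h + α) × Block (i + (α + β)) γ (h + (α + β))

  SkewSum : ℕ → ℕ → ℕ → ℕ → ℕ → Set
  SkewSum i α β γ h = Block i α (h + γ + β) × Block (i + α) β (h + γ) × Block (i + (α + β)) γ h

  DirectSum⇒Block : ∀ {i α β γ h} → DirectSum i α β γ h → Block i (α + β + γ) h
  DirectSum⇒Block (A , B , C) = Block-⊕ (Block-⊕ A B) C

  SkewSum⇒Block : ∀ {i α β γ h} → SkewSum i α β γ h → Block i (α + β + γ) h
  SkewSum⇒Block (A , B , C) = Block-⊖ (Block-⊖ A B) C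

  BlockSum : ℕ → ℕ → ℕ → ℕ → Set
  BlockSum i α β γ = Σ ℕ (DirectSum i α β γ) ⊎ Σ ℕ (SkewSum i α β γ)

  Pattern : Set
  Pattern = Σ (ℕ × ℕ) λ I → IsInterval w I ×
            (Σ ℕ λ a → Σ ℕ λ b → Σ ℕ λ c →
             Σ (Permutation′ (suc a)) λ p₁ →
             Σ (Permutation′ (suc b)) λ p₂ →
             Σ (Permutation′ (suc c)) λ p₃ →
               OrderIso (subword w I) (oneLine p₁ ⊕ oneLine p₂ ⊕ oneLine p₃)
             ⊎ OrderIso (subword w I) (oneLine p₁ ⊖ oneLine p₂ ⊖ oneLine p₃))

  private
    subword-orderIso : ∀ {i k h} → Block i (suc k) h → ∀ {L} → L ≡ standardized i h (suc k) →
                     OrderIso (subword w (h , k)) L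
    subword-orderIso B L≡ = subst₂ OrderIso (sym (subword-Block B)) (sym L≡)
      (applyUpTo-orderIso _ λ s<ℓ t<ℓ → ∸-<-⇔ (proj₁ (proj₂ B s<ℓ)) (proj₁ (proj₂ B t<ℓ)))

    standardized-shift : ∀ {i d m h} → Block (i + d) m (h + d) → ∀ {u} → u < m →
              W (i + d + u) ∸ (h + d) + d ≡ W (i + (d + u)) ∸ h
    standardized-shift {i} {d} {h = h} B {u} u<m =
      trans (∸-shift h d (proj₁ (proj₂ B u<m))) (cong (λ t → W t ∸ h) (+-assoc i d u))

  DirectSum⇒Pattern : ∀ {i a b c h} → DirectSum i (suc a) (suc b) (suc c) h → Pattern
  DirectSum⇒Pattern {i} {a} {b} {c} {h} sum@(A , B , C)
    with p₁ , p₁≡ ← standardize A | p₂ , p₂≡ ← standardize B | p₃ , p₃≡ ← standardize C =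
    (h , a + suc b + suc c) , Block⇒IsInterval U , a , b , c , p₁ , p₂ , p₃ , inj₁ (subword-orderIso U word)
    where
    U : Block i (suc a + suc b + suc c) h
    U = DirectSum⇒Block sum
    C-word : List ℕ
    C-word = standardized (i + (suc a + suc b)) (h + (suc a + suc b)) (suc c)
    word : oneLine p₁ ⊕ oneLine p₂ ⊕ oneLine p₃ ≡ standardized i h (suc a + suc b + suc c)
    word = trans (cong₂ _⊕_ (cong₂ _⊕_ p₁≡ p₂≡) p₃≡) (trans
      (cong (_⊕ C-word) (applyUpTo-⊕ {F = F} (suc a) (suc b) (λ _ → refl) (standardized-shift {i} {h = h} B)))
      (applyUpTo-⊕ {F = F} (suc a + suc b) (suc c) (λ _ → refl) (standardized-shift {i} {h = h} C)))
      where
      F : ℕ → ℕ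
      F s = W (i + s) ∸ h

  SkewSum⇒Pattern : ∀ {i a b c h} → SkewSum i (suc a) (suc b) (suc c) h → Pattern
  SkewSum⇒Pattern {i} {a} {b} {c} {h} sum@(A , B , C)
    with p₁ , p₁≡ ← standardize A | p₂ , p₂≡ ← standardize B | p₃ , p₃≡ ← standardize C =
    (h , a + suc b + suc c) , Block⇒IsInterval U , a , b , c , p₁ , p₂ , p₃ , inj₂ (subword-orderIso U word)
    where
    U : Block i (suc a + suc b + suc c) h
    U = SkewSum⇒Block sum
    AB : Block i (suc a + suc b) (h + suc c)
    AB = Block-⊖ A B
    C-word : List ℕ
    C-word = standardized (i + (suc a + suc b)) h (suc c)
    word : oneLine p₁ ⊖ oneLine p₂ ⊖ oneLine p₃ ≡ standardized i h (suc a + suc b + suc c)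
    word = trans (cong₂ _⊖_ (cong₂ _⊖_ p₁≡ p₂≡) p₃≡) (trans
      (cong (_⊖ C-word) (applyUpTo-⊖ {F = λ s → W (i + s) ∸ (h + suc c)} (suc a) (suc b)
        (λ s<α → ∸-shift (h + suc c) (suc b) (proj₁ (proj₂ A s<α)))
        (λ {u} _ → cong (λ t → W t ∸ (h + suc c)) (+-assoc i (suc a) u))))
      (applyUpTo-⊖ {F = λ s → W (i + s) ∸ h} (suc a + suc b) (suc c)
        (λ s<α+β → ∸-shift h (suc c) (proj₁ (proj₂ AB s<α+β)))
        (λ {u} _ → cong (λ t → W t ∸ h) (+-assoc i (suc a + suc b) u))))

  BlockSum⇒Pattern : ∀ {i a b c} → BlockSum i (suc a) (suc b) (suc c) → Pattern
  BlockSum⇒Pattern (inj₁ (_ , sum)) = DirectSum⇒Pattern sum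
  BlockSum⇒Pattern (inj₂ (_ , sum)) = SkewSum⇒Pattern sum

  private
    word-orderIso-reflects : ∀ {i ℓ L} → OrderIso (applyUpTo (λ s → W (i + s)) ℓ) L →
               ∀ {s t} → s < ℓ → t < ℓ → nth L s < nth L t → W (i + s) < W (i + t)
    word-orderIso-reflects {i} {ℓ} {L} iso {s} {t} s<ℓ t<ℓ =
      subst₂ _<_ (nth-applyUpTo f s<ℓ) (nth-applyUpTo f t<ℓ) ∘
      orderIso-reflects {applyUpTo f ℓ} {L} iso (subst (s <_) (sym (length-applyUpTo _ ℓ)) s<ℓ)
                                                (subst (t <_) (sym (length-applyUpTo _ ℓ)) t<ℓ)
      where
      f : ℕ → ℕ
      f s = W (i + s)

    subword-orderIso-length : ∀ {i k h L} → Block i (suc k) h → OrderIso (subword w (h , k)) L →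
                     ∀ {ℓ} → length L ≡ ℓ → Block i ℓ h × OrderIso (applyUpTo (λ s → W (i + s)) ℓ) L
    subword-orderIso-length {i} {k} {h} {L} B iso {ℓ} L≡ℓ =
      subst (λ m → Block i m h) k+1≡ℓ B ,
      subst (λ m → OrderIso (applyUpTo (λ s → W (i + s)) m) L) k+1≡ℓ iso′
      where
      iso′ : OrderIso (applyUpTo (λ s → W (i + s)) (suc k)) L
      iso′ = subst (λ l → OrderIso l L) (subword-Block B) iso
      k+1≡ℓ : suc k ≡ ℓ
      k+1≡ℓ = trans (sym (length-applyUpTo (λ s → W (i + s)) (suc k))) (trans (proj₁ iso′) L≡ℓ)

  ⊕-orderIso⇒DirectSum : ∀ {i h α β γ X Y Z} → length X ≡ α → length Y ≡ β → length Z ≡ γ →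
    All (_< α) X → All (_< β) Y → Block i (α + β + γ) h →
    OrderIso (applyUpTo (λ s → W (i + s)) (α + β + γ)) (X ⊕ Y ⊕ Z) → DirectSum i α β γ h
  ⊕-orderIso⇒DirectSum {i} {h} {X = X} {Y} {Z} refl refl refl X< Y< U iso =
    proj₁ A∣B , proj₂ A∣B , proj₂ AB∣C
    where
    XY : List ℕ
    XY = X ⊕ Y
    |XY| : length XY ≡ length X + length Y
    |XY| = length-⊕ X Y
    |XYZ| : length (XY ⊕ Z) ≡ length X + length Y + length Z
    |XYZ| = trans (length-⊕ XY Z) (cong (_+ length Z) |XY|)
    ascent-XY|Z : Ascent i (length X + length Y) (length Z)
    ascent-XY|Z {s} {t} s< ≤t t< = word-orderIso-reflects {L = XY ⊕ Z} iso (<-≤-trans s< (m≤m+n _ _)) t<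
      (⊕-cut XY Z (⊕-bounded X< Y<) (subst (s <_) (sym |XY|) s<) (subst (_≤ t) (sym |XY|) ≤t)
                                      (subst (t <_) (sym |XYZ|) t<))
    AB∣C : Block i (length X + length Y) h × Block (i + (length X + length Y)) (length Z) (h + (length X + length Y))
    AB∣C = Block-split⊕ U ascent-XY|Z
    ascent-X|Y : Ascent i (length X) (length Y)
    ascent-X|Y {s} {t} s< ≤t t< = word-orderIso-reflects {L = XY ⊕ Z} iso (into-XYZ s<XY) (into-XYZ t<XY)
      (subst₂ _<_ (sym (nth-++ˡ XY Z′ s<XY)) (sym (nth-++ˡ XY Z′ t<XY)) (⊕-cut X Y X< s< ≤t t<XY))
      where
      s<XY : s < length XY
      s<XY = subst (s <_) (sym |XY|) (<-≤-trans s< (m≤m+n _ _))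
      t<XY : t < length XY
      t<XY = subst (t <_) (sym |XY|) t<
      Z′ : List ℕ
      Z′ = map (_+ length XY) Z
      into-XYZ : ∀ {u} → u < length XY → u < length X + length Y + length Z
      into-XYZ u< = <-≤-trans (subst (_ <_) |XY| u<) (m≤m+n _ _)
    A∣B : Block i (length X) h × Block (i + length X) (length Y) (h + length X)
    A∣B = Block-split⊕ (proj₁ AB∣C) ascent-X|Y

  ⊖-orderIso⇒SkewSum : ∀ {i h α β γ X Y Z} → length X ≡ α → length Y ≡ β → length Z ≡ γ →
    All (_< β) Y → All (_< γ) Z → Block i (α + β + γ) h →
    OrderIso (applyUpTo (λ s → W (i + s)) (α + β + γ)) (X ⊖ Y ⊖ Z) → SkewSum i α β γ h
  ⊖-orderIso⇒SkewSum {i} {h} {X = X} {Y} {Z} refl refl refl Y< Z< U iso =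
    proj₁ A∣B , proj₂ A∣B , proj₂ AB∣C
    where
    XY : List ℕ
    XY = X ⊖ Y
    |XY| : length XY ≡ length X + length Y
    |XY| = length-⊖ X Y
    |XYZ| : length (XY ⊖ Z) ≡ length X + length Y + length Z
    |XYZ| = trans (length-⊖ XY Z) (cong (_+ length Z) |XY|)
    descent-XY|Z : Descent i (length X + length Y) (length Z)
    descent-XY|Z {s} {t} s< ≤t t< = word-orderIso-reflects {L = XY ⊖ Z} iso t< (<-≤-trans s< (m≤m+n _ _))
      (⊖-cut XY Z Z< (subst (s <_) (sym |XY|) s<) (subst (_≤ t) (sym |XY|) ≤t) (subst (t <_) (sym |XYZ|) t<))
    AB∣C : Block i (length X + length Y) (h + length Z) × Block (i + (length X + length Y)) (length Z) h
    AB∣C = Block-split⊖ U descent-XY|Z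
    descent-X|Y : Descent i (length X) (length Y)
    descent-X|Y {s} {t} s< ≤t t< = word-orderIso-reflects {L = XY ⊖ Z} iso (into-XYZ t<XY) (into-XYZ s<XY)
      (subst₂ _<_ (sym (at t<XY)) (sym (at s<XY)) (+-monoˡ-< (length Z) (⊖-cut X Y Y< s< ≤t t<XY)))
      where
      s<XY : s < length XY
      s<XY = subst (s <_) (sym |XY|) (<-≤-trans s< (m≤m+n _ _))
      t<XY : t < length XY
      t<XY = subst (t <_) (sym |XY|) t<
      into-XYZ : ∀ {u} → u < length XY → u < length X + length Y + length Z
      into-XYZ u< = <-≤-trans (subst (_ <_) |XY| u<) (m≤m+n _ _)
      at : ∀ {u} → u < length XY → nth (XY ⊖ Z) u ≡ nth XY u + length Z
      at {u} u< = trans (nth-++ˡ (map (_+ length Z) XY) Z (subst (u <_) (sym (length-map _ XY)) u<))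
                        (nth-map (_+ length Z) XY u<)
    A∣B : Block i (length X) (h + length Z + length Y) × Block (i + length X) (length Y) (h + length Z)
    A∣B = Block-split⊖ (proj₁ AB∣C) descent-X|Y

  Pattern⇒BlockSum : Pattern →
                     Σ ℕ λ i → Σ ℕ λ a → Σ ℕ λ b → Σ ℕ λ c → BlockSum i (suc a) (suc b) (suc c)
  Pattern⇒BlockSum ((h , k) , I , a , b , c , p₁ , p₂ , p₃ , iso) with i , U ← IsInterval⇒Block I =
    i , a , b , c , sum iso
    where
    X Y Z : List ℕ
    X = oneLine p₁
    Y = oneLine p₂
    Z = oneLine p₃
    sum : OrderIso (subword w (h , k)) (X ⊕ Y ⊕ Z) ⊎ OrderIso (subword w (h , k)) (X ⊖ Y ⊖ Z) →
          BlockSum i (suc a) (suc b) (suc c)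
    sum (inj₁ iso⊕) = inj₁ (h , uncurry
      (⊕-orderIso⇒DirectSum (length-oneLine p₁) (length-oneLine p₂) (length-oneLine p₃)
                             (oneLine-bounded p₁) (oneLine-bounded p₂))
      (subword-orderIso-length U iso⊕ |XYZ|))
      where
      |XYZ| : length (X ⊕ Y ⊕ Z) ≡ suc a + suc b + suc c
      |XYZ| = trans (length-⊕ (X ⊕ Y) Z) (cong₂ _+_ (trans (length-⊕ X Y)
                (cong₂ _+_ (length-oneLine p₁) (length-oneLine p₂))) (length-oneLine p₃))
    sum (inj₂ iso⊖) = inj₂ (h , uncurry
      (⊖-orderIso⇒SkewSum (length-oneLine p₁) (length-oneLine p₂) (length-oneLine p₃)
                           (oneLine-bounded p₂) (oneLine-bounded p₃))
      (subword-orderIso-length U iso⊖ |XYZ|))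
      where
      |XYZ| : length (X ⊖ Y ⊖ Z) ≡ suc a + suc b + suc c
      |XYZ| = trans (length-⊖ (X ⊖ Y) Z) (cong₂ _+_ (trans (length-⊖ X Y)
                (cong₂ _+_ (length-oneLine p₁) (length-oneLine p₂))) (length-oneLine p₃))

  -- Overlapping blocks

  -- X = A·B and Y = B·C, where A, B, C are consecutive runs of suc a, suc b, suc c positions.
  record Overlap (i a b c : ℕ) : Set where
    constructor mkOverlap
    field
      {h₁ h₂} : ℕ
      left    : Block i (suc a + suc b) h₁
      right   : Block (i + suc a) (suc b + suc c) h₂

  BlockSum⇒Overlap : ∀ {i a b c} → BlockSum i (suc a) (suc b) (suc c) → Overlap i a b c
  BlockSum⇒Overlap {i} {a} {b} {c} (inj₁ (h , A , B , C)) =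
    mkOverlap (Block-⊕ A B) (Block-⊕ B (subst₂ (λ j g → Block j (suc c) g) (sym (+-assoc i (suc a) (suc b)))
                                                              (sym (+-assoc h (suc a) (suc b))) C))
  BlockSum⇒Overlap {i} {a} {b} {c} (inj₂ (h , A , B , C)) =
    mkOverlap (Block-⊖ A B) (Block-⊖ B (subst (λ j → Block j (suc c) h) (sym (+-assoc i (suc a) (suc b))) C))

  -- Counting the values of B, and those of C (resp. A), forces h₂ = h₁ + |A| (resp. h₁ = h₂ + |C|).
  module Decomposition {i a b c h₁ h₂ : ℕ}
                       (X : Block i (suc a + suc b) h₁) (Y : Block (i + suc a) (suc b + suc c) h₂) where

    private
      α β γ : ℕ
      α = suc a
      β = suc b
      γ = suc c

      B-in-Y : ∀ {u} → u < β → u < β + γ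
      B-in-Y u<β = <-≤-trans u<β (m≤m+n β γ)

      B-in-X : ∀ {u} → u < β → h₁ ≤ W (i + α + u) × W (i + α + u) < h₁ + (α + β)
      B-in-X {u} u<β =
        subst (λ t → h₁ ≤ W t × W t < h₁ + (α + β)) (sym (+-assoc i α u)) (proj₂ X (+-monoʳ-< α u<β))

      B-injective : InjectiveOn β (λ u → W (i + α + u))
      B-injective u<β v<β = Block-injective Y (B-in-Y u<β) (B-in-Y v<β)

      regroup : ∀ x y z u → x + (y + z) + u ≡ x + y + (z + u)
      regroup = solve-∀

      regroup′ : ∀ x y z → x + (y + z) ≡ x + z + y
      regroup′ = solve-∀

      regroup″ : ∀ x y z u → x + (y + z) + u ≡ x + z + (u + y)
      regroup″ = solve-∀

      position-in-Y : ∀ {u} → u < β + γ → i + α + u < n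
      position-in-Y u< = <-≤-trans (+-monoʳ-< (i + α) u<) (proj₁ Y)

    direct : h₁ ≤ h₂ → DirectSum i α β γ h₁
    direct h₁≤h₂ = A , B , C
      where
      C-above-X : ∀ {u} → u < γ → h₁ + (α + β) ≤ W (i + α + (β + u))
      C-above-X {u} u<γ = Block-above X (position-in-Y (+-monoʳ-< β u<γ))
        (λ (_ , t<i+[α+β]) → <⇒≱ t<i+[α+β]
          (subst (_≤ i + α + (β + u)) (+-assoc i α β) (+-monoʳ-≤ (i + α) (m≤m+n β u))))
        (≤-trans h₁≤h₂ (proj₁ (proj₂ Y (+-monoʳ-< β u<γ))))
      h₂≤h₁+α : h₂ ≤ h₁ + α
      h₂≤h₁+α = +-cancelʳ-≤ β h₂ (h₁ + α) (subst (h₂ + β ≤_) (sym (+-assoc h₁ α β))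
        (injectiveOn-between⇒≤ (≤-trans (proj₁ (proj₂ Y (B-in-Y z<s))) (<⇒≤ (proj₂ (B-in-X z<s))))
               (λ u<β → proj₁ (proj₂ Y (B-in-Y u<β)) , proj₂ (B-in-X u<β)) B-injective))
      h₁+α≤h₂ : h₁ + α ≤ h₂
      h₁+α≤h₂ = +-cancelʳ-≤ (β + γ) (h₁ + α) h₂ (subst (_≤ h₂ + (β + γ)) (regroup h₁ α β γ)
        (injectiveOn-between⇒≤ (≤-trans (C-above-X z<s) (<⇒≤ (proj₂ (proj₂ Y (+-monoʳ-< β z<s)))))
               (λ u<γ → C-above-X u<γ , proj₂ (proj₂ Y (+-monoʳ-< β u<γ)))
               (λ u<γ v<γ → +-cancelˡ-≡ β _ _ ∘ Block-injective Y (+-monoʳ-< β u<γ) (+-monoʳ-< β v<γ))))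
      h₂≡h₁+α : h₂ ≡ h₁ + α
      h₂≡h₁+α = ≤-antisym h₂≤h₁+α h₁+α≤h₂
      h₁+[α+β]≡h₂+β : h₁ + (α + β) ≡ h₂ + β
      h₁+[α+β]≡h₂+β = trans (sym (+-assoc h₁ α β)) (cong (_+ β) (sym h₂≡h₁+α))
      C′ : Block (i + α + β) γ (h₂ + β)
      C′ = Block-suffix-above Y λ {u} u<γ →
        subst (_≤ W (i + α + (β + u))) h₁+[α+β]≡h₂+β (C-above-X u<γ)
      B : Block (i + α) β (h₁ + α)
      B = subst (Block (i + α) β) h₂≡h₁+α (Block-⊕⁻ˡ Y C′)
      A : Block i α h₁
      A = Block-⊕⁻ˡ X B
      C : Block (i + (α + β)) γ (h₁ + (α + β))
      C = subst₂ (λ j g → Block j γ g) (+-assoc i α β) (sym h₁+[α+β]≡h₂+β) C′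

    skew : h₂ < h₁ → SkewSum i α β γ h₂
    skew h₂<h₁ = A , B , C
      where
      A-in-X : ∀ {s} → s < α → s < α + β
      A-in-X s<α = <-≤-trans s<α (m≤m+n α β)
      A-above-Y : ∀ {s} → s < α → h₂ + (β + γ) ≤ W (i + s)
      A-above-Y {s} s<α = Block-above Y (<-≤-trans (+-monoʳ-< i (A-in-X s<α)) (proj₁ X))
        (λ (i+α≤i+s , _) → <⇒≱ s<α (+-cancelˡ-≤ i α s i+α≤i+s))
        (≤-trans (<⇒≤ h₂<h₁) (proj₁ (proj₂ X (A-in-X s<α))))
      h₁≤h₂+γ : h₁ ≤ h₂ + γ
      h₁≤h₂+γ = +-cancelʳ-≤ β h₁ (h₂ + γ) (subst (h₁ + β ≤_) (regroup′ h₂ β γ)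
        (injectiveOn-between⇒≤ (≤-trans (proj₁ (B-in-X z<s)) (<⇒≤ (proj₂ (proj₂ Y (B-in-Y z<s)))))
               (λ u<β → proj₁ (B-in-X u<β) , proj₂ (proj₂ Y (B-in-Y u<β))) B-injective))
      h₂+γ≤h₁ : h₂ + γ ≤ h₁
      h₂+γ≤h₁ = +-cancelʳ-≤ (α + β) (h₂ + γ) h₁ (subst (_≤ h₁ + (α + β)) (regroup″ h₂ β γ α)
        (injectiveOn-between⇒≤ (≤-trans (A-above-Y z<s) (<⇒≤ (proj₂ (proj₂ X (A-in-X z<s)))))
               (λ s<α → A-above-Y s<α , proj₂ (proj₂ X (A-in-X s<α)))
               (λ s<α t<α → Block-injective X (A-in-X s<α) (A-in-X t<α))))
      h₁≡h₂+γ : h₁ ≡ h₂ + γ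
      h₁≡h₂+γ = ≤-antisym h₁≤h₂+γ h₂+γ≤h₁
      h₂+[β+γ]≡h₁+β : h₂ + (β + γ) ≡ h₁ + β
      h₂+[β+γ]≡h₁+β = trans (regroup′ h₂ β γ) (cong (_+ β) (sym h₁≡h₂+γ))
      A′ : Block i α (h₁ + β)
      A′ = Block-prefix-above X (λ {s} s<α → subst (_≤ W (i + s)) h₂+[β+γ]≡h₁+β (A-above-Y s<α))
      B : Block (i + α) β (h₂ + γ)
      B = subst (Block (i + α) β) h₁≡h₂+γ (Block-⊖⁻ʳ X A′)
      A : Block i α (h₂ + γ + β)
      A = subst (λ g → Block i α (g + β)) h₁≡h₂+γ A′
      C : Block (i + (α + β)) γ h₂
      C = subst (λ j → Block j γ h₂) (+-assoc i α β) (Block-⊖⁻ʳ Y B)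

  Overlap⇒BlockSum : ∀ {i a b c} → Overlap i a b c → BlockSum i (suc a) (suc b) (suc c)
  Overlap⇒BlockSum (mkOverlap {h₁} {h₂} X Y) with h₁ ≤? h₂
  ... | yes h₁≤h₂ = inj₁ (h₁ , Decomposition.direct X Y h₁≤h₂)
  ... | no  h₁≰h₂ = inj₂ (h₂ , Decomposition.skew X Y (≰⇒> h₁≰h₂))

  Overlap-∩ : ∀ {i a b c} → Overlap i a b c → ∃ λ h → Block (i + suc a) (suc b) h
  Overlap-∩ o with Overlap⇒BlockSum o
  ... | inj₁ (_ , _ , B , _) = _ , B
  ... | inj₂ (_ , _ , B , _) = _ , B

  Overlap-∪ : ∀ {i a b c} → Overlap i a b c → ∃ λ h → Block i (suc a + suc b + suc c) h
  Overlap-∪ o with Overlap⇒BlockSum o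
  ... | inj₁ (h , sum) = h , DirectSum⇒Block sum
  ... | inj₂ (h , sum) = h , SkewSum⇒Block sum

  overlapping⇒Overlap : ∀ {i₁ ℓ₁ h₁ i₂ ℓ₂ h₂} → Block i₁ ℓ₁ h₁ → Block i₂ ℓ₂ h₂ →
               i₁ < i₂ → i₂ < i₁ + ℓ₁ → i₁ + ℓ₁ < i₂ + ℓ₂ →
               Σ ℕ λ a → Σ ℕ λ b → Σ ℕ λ c → i₁ + suc a ≡ i₂ × i₂ + suc b ≡ i₁ + ℓ₁ × Overlap i₁ a b c
  overlapping⇒Overlap {i₁} {ℓ₁} {h₁} {i₂} {ℓ₂} {h₂} X Y i₁<i₂ i₂<e₁ e₁<e₂ =
    a , b , c , i₁+α≡i₂ , i₂+β≡e₁ ,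
    mkOverlap (subst (λ ℓ → Block i₁ ℓ h₁) ℓ₁≡α+β X)
              (subst₂ (λ j ℓ → Block j ℓ h₂) (sym i₁+α≡i₂) ℓ₂≡β+γ Y)
    where
    a b c : ℕ
    a = proj₁ (<⇒∃+suc i₁<i₂)
    b = proj₁ (<⇒∃+suc i₂<e₁)
    c = proj₁ (<⇒∃+suc e₁<e₂)
    i₁+α≡i₂ : i₁ + suc a ≡ i₂
    i₁+α≡i₂ = proj₂ (<⇒∃+suc i₁<i₂)
    i₂+β≡e₁ : i₂ + suc b ≡ i₁ + ℓ₁
    i₂+β≡e₁ = proj₂ (<⇒∃+suc i₂<e₁)
    ℓ₁≡α+β : ℓ₁ ≡ suc a + suc b
    ℓ₁≡α+β = +-cancelˡ-≡ i₁ _ _ (begin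
      i₁ + ℓ₁                ≡⟨ i₂+β≡e₁ ⟨
      i₂ + suc b             ≡⟨ cong (_+ suc b) i₁+α≡i₂ ⟨
      i₁ + suc a + suc b     ≡⟨ +-assoc i₁ (suc a) (suc b) ⟩
      i₁ + (suc a + suc b)   ∎)
      where open ≡-Reasoning
    ℓ₂≡β+γ : ℓ₂ ≡ suc b + suc c
    ℓ₂≡β+γ = +-cancelˡ-≡ i₂ _ _ (begin
      i₂ + ℓ₂                ≡⟨ proj₂ (<⇒∃+suc e₁<e₂) ⟨
      i₁ + ℓ₁ + suc c        ≡⟨ cong (_+ suc c) i₂+β≡e₁ ⟨
      i₂ + suc b + suc c     ≡⟨ +-assoc i₂ (suc b) (suc c) ⟩
      i₂ + (suc b + suc c)   ∎)
      where open ≡-Reasoning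

  overlapping-∩ : ∀ {i₁ ℓ₁ h₁ i₂ ℓ₂ h₂} → Block i₁ ℓ₁ h₁ → Block i₂ ℓ₂ h₂ →
                 i₁ < i₂ → i₂ < i₁ + ℓ₁ → i₁ + ℓ₁ < i₂ + ℓ₂ →
                 Σ ℕ λ b → i₂ + suc b ≡ i₁ + ℓ₁ × ∃ λ h → Block i₂ (suc b) h
  overlapping-∩ X Y i₁<i₂ i₂<e₁ e₁<e₂
    with _ , b , _ , refl , e , o ← overlapping⇒Overlap X Y i₁<i₂ i₂<e₁ e₁<e₂ =
    b , e , Overlap-∩ o

  -- Without the pattern the Hasse diagram is a tree

  open HasseDiagram (IsInterval w) _⊂I_ proj₂ ⊂I⇒proj₂<

  Between? : ∀ x y → Dec (Between x y)
  Between? x y@(g , m) = map′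
    (λ (h , _ , k , _ , between) → (h , k) , between)
    (λ ((h , k) , between@(_ , _ , K⊂y)) →
      h , s≤s (≤-trans (m≤m+n h k) (proj₂ (⊆I⇒⊑ (proj₁ K⊂y)))) , k , ⊂I⇒proj₂< K⊂y , between)
    (anyUpTo? (λ h → anyUpTo? (λ k → IsInterval? (h , k) ×-dec ⊂I? x (h , k) ×-dec ⊂I? (h , k) y) m)
              (suc (g + m)))

  top : ℕ × ℕ
  top = 0 , pred n

  top-interval : ∀ {x} → IsInterval w x → IsInterval w top
  top-interval (_ , i+k<n , _) = Block⇒IsInterval {0} (m≤pred[n]⇒suc[m]≤n ≤-refl , values)
    where
    instance
      n≢0 : NonZero n
      n≢0 = >-nonZero (≤-<-trans z≤n i+k<n)
    values : MapsInto W (suc (pred n)) 0 (suc (pred n))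
    values {s} s<n = z≤n , subst (W s <_) (sym (suc-pred n)) (W<n (m≤pred[n]⇒suc[m]≤n (s≤s⁻¹ s<n)))

  IsInterval⇒<n : ∀ {h k} → IsInterval w (h , k) → h + k < n
  IsInterval⇒<n {h} {k} (_ , _ , _ , onto) =
    let t , _ , _ , val≡h+k = onto (h + k) (m≤m+n h k) ≤-refl in subst (_< n) val≡h+k (toℕ<n (w ⟨$⟩ʳ t))

  below-top : ∀ {x} → IsInterval w x → x ≡ top ⊎ x ⊂I top
  below-top {x} vx with ≡-dec _≟_ _≟_ x top
  ... | yes x≡top = inj₁ x≡top
  ... | no  x≢top = inj₂ (⊑⇒⊆I (z≤n , suc[m]≤n⇒m≤pred[n] (IsInterval⇒<n vx)) , x≢top)

  intervals-connected : Connected (IsInterval w) Edge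
  intervals-connected x y vx vy = connected Between? top (top-interval vx) below-top x y vx vy

  overlap⇒Pattern : ∀ {i₁ ℓ₁ h₁ i₂ ℓ₂ h₂} → Block i₁ ℓ₁ h₁ → Block i₂ ℓ₂ h₂ →
                    i₁ < i₂ → i₂ < i₁ + ℓ₁ → i₁ + ℓ₁ < i₂ + ℓ₂ → Pattern
  overlap⇒Pattern X Y i₁<i₂ i₂<e₁ e₁<e₂ =
    let _ , _ , _ , _ , _ , o = overlapping⇒Overlap X Y i₁<i₂ i₂<e₁ e₁<e₂
    in BlockSum⇒Pattern (Overlap⇒BlockSum o)

  nested-unless-pattern : ¬ Pattern → ∀ {i₁ k₁ h₁ i₂ k₂ h₂} → Block i₁ (suc k₁) h₁ → Block i₂ (suc k₂) h₂ →
                          i₂ ≤ i₁ + k₁ → i₁ ≤ i₂ + k₂ → (i₁ , k₁) ⊑ (i₂ , k₂) ⊎ (i₂ , k₂) ⊑ (i₁ , k₁)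
  nested-unless-pattern ¬pattern {i₁} {k₁} {_} {i₂} {k₂} B₁ B₂ i₂≤e₁ i₁≤e₂
    with <-cmp i₁ i₂ | i₁ + k₁ ≤? i₂ + k₂ | i₂ + k₂ ≤? i₁ + k₁
  ... | tri≈ _ i₁≡i₂ _ | yes e₁≤e₂ | _         = inj₁ (≤-reflexive (sym i₁≡i₂) , e₁≤e₂)
  ... | tri≈ _ i₁≡i₂ _ | no  e₁≰e₂ | _ = inj₂ (≤-reflexive i₁≡i₂ , <⇒≤ (≰⇒> e₁≰e₂))
  ... | tri> _ _ i₂<i₁ | yes e₁≤e₂ | _         = inj₁ (<⇒≤ i₂<i₁ , e₁≤e₂)
  ... | tri> _ _ i₂<i₁ | no  e₁≰e₂ | _         =
    ⊥-elim (¬pattern (overlap⇒Pattern B₂ B₁ i₂<i₁ (≤⇒<+suc i₂ k₂ i₁≤e₂) (+suc-mono-< (≰⇒> e₁≰e₂))))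
  ... | tri< i₁<i₂ _ _ | _         | yes e₂≤e₁ = inj₂ (<⇒≤ i₁<i₂ , e₂≤e₁)
  ... | tri< i₁<i₂ _ _ | _         | no  e₂≰e₁ =
    ⊥-elim (¬pattern (overlap⇒Pattern B₁ B₂ i₁<i₂ (≤⇒<+suc i₁ k₁ i₂≤e₁) (+suc-mono-< (≰⇒> e₂≰e₁))))

  private
    Cover-minimal : ∀ {x y z} → IsInterval w y → x ⊂I y → y ⊆I z → ¬ Between x z → y ≡ z
    Cover-minimal {y = y} {z} vy x⊂y y⊆z ∄between with ≡-dec _≟_ _≟_ y z
    ... | yes y≡z = y≡z
    ... | no  y≢z = ⊥-elim (∄between (y , vy , x⊂y , y⊆z , y≢z))

  unique-cover : ¬ Pattern → ∀ {x y z} → IsInterval w x → IsInterval w y → IsInterval w z →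
                 Cover x y → Cover x z → y ≡ z
  unique-cover ¬pattern {hx , kx} {hy , ky} {hz , kz} vx vy vz (x⊂y , ∄x<·<y) (x⊂z , ∄x<·<z) =
    Sum.[ (λ y⊑z → Cover-minimal vy x⊂y (⊑⇒⊆I (positions⊑⇒values⊑ Y Z y⊑z)) ∄x<·<z)
        , (λ z⊑y → sym (Cover-minimal vz x⊂z (⊑⇒⊆I (positions⊑⇒values⊑ Z Y z⊑y)) ∄x<·<y)) ]′
      (nested-unless-pattern ¬pattern Y Z (≤-trans (proj₁ x⊑z) (≤-trans (m≤m+n _ _) (proj₂ x⊑y)))
                                          (≤-trans (proj₁ x⊑y) (≤-trans (m≤m+n _ _) (proj₂ x⊑z))))
    where
    ix iy iz : ℕ
    ix = proj₁ (IsInterval⇒Block vx)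
    iy = proj₁ (IsInterval⇒Block vy)
    iz = proj₁ (IsInterval⇒Block vz)
    X : Block ix (suc kx) hx
    X = proj₂ (IsInterval⇒Block vx)
    Y : Block iy (suc ky) hy
    Y = proj₂ (IsInterval⇒Block vy)
    Z : Block iz (suc kz) hz
    Z = proj₂ (IsInterval⇒Block vz)
    x⊑y : (ix , kx) ⊑ (iy , ky)
    x⊑y = values⊑⇒positions⊑ X Y (⊆I⇒⊑ (proj₁ x⊂y))
    x⊑z : (ix , kx) ⊑ (iz , kz)
    x⊑z = values⊑⇒positions⊑ X Z (⊆I⇒⊑ (proj₁ x⊂z))

  pattern-free⇒tree : ¬ Pattern → HasseIsTree w
  pattern-free⇒tree ¬pattern = intervals-connected , acyclic (unique-cover ¬pattern)

  -- With the pattern the Hasse diagram has a cycle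

  SmallerOverlap : ℕ → Set
  SmallerOverlap m = Σ ℕ λ i → Σ ℕ λ a → Σ ℕ λ b → Σ ℕ λ c → Overlap i a b c × a + c < m

  shrink-left : ∀ {i a b c j ℓ g} → Overlap i a b c → Block j ℓ g →
                i < j → j < i + suc a → j + ℓ ≡ i + suc a + suc b → SmallerOverlap (a + c)
  shrink-left {i} {a} {b} {c} {j} {ℓ} {g} o K i<j j<i+α j+ℓ≡ =
    j , a′ , b , c ,
    mkOverlap (subst (λ ℓ → Block j ℓ g) ℓ≡α′+β K)
              (subst (λ p → Block p (suc b + suc c) (Overlap.h₂ o)) (sym j+α′≡i+α) (Overlap.right o)) ,
    +-monoˡ-< c a′<a
    where
    a′ : ℕ
    a′ = proj₁ (<⇒∃+suc j<i+α)
    j+α′≡i+α : j + suc a′ ≡ i + suc a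
    j+α′≡i+α = proj₂ (<⇒∃+suc j<i+α)
    ℓ≡α′+β : ℓ ≡ suc a′ + suc b
    ℓ≡α′+β = +-cancelˡ-≡ j _ _
      (trans j+ℓ≡ (trans (cong (_+ suc b) (sym j+α′≡i+α)) (+-assoc j (suc a′) (suc b))))
    a′<a : a′ < a
    a′<a = s≤s⁻¹ (+-cancelˡ-< i _ _ (subst (i + suc a′ <_) j+α′≡i+α (+-monoˡ-< (suc a′) i<j)))

  shrink-right : ∀ {i a b c ℓ g} → Overlap i a b c → Block (i + suc a) ℓ g →
                 suc b < ℓ → ℓ < suc b + suc c → SmallerOverlap (a + c)
  shrink-right {i} {a} {b} {c} {ℓ} {g} o K β<ℓ ℓ<β+γ =
    i , a , b , d , mkOverlap (Overlap.left o) (subst (λ ℓ → Block (i + suc a) ℓ g) (sym β+δ≡ℓ) K) ,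
    +-monoʳ-< a (s≤s⁻¹ (+-cancelˡ-< (suc b) _ _ (subst (_< suc b + suc c) (sym β+δ≡ℓ) ℓ<β+γ)))
    where
    d : ℕ
    d = proj₁ (<⇒∃+suc β<ℓ)
    β+δ≡ℓ : suc b + suc d ≡ ℓ
    β+δ≡ℓ = proj₂ (<⇒∃+suc β<ℓ)

  module Square {i a b c : ℕ} (o : Overlap i a b c) where
    open Overlap o renaming (left to X; right to Y)

    private
      hB hU : ℕ
      hB = proj₁ (Overlap-∩ o)
      hU = proj₁ (Overlap-∪ o)
      B : Block (i + suc a) (suc b) hB
      B = proj₂ (Overlap-∩ o)
      U : Block i (suc a + suc b + suc c) hU
      U = proj₂ (Overlap-∪ o)

      eB≡eX : i + suc a + suc b ≡ i + (suc a + suc b)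
      eB≡eX = +-assoc i (suc a) (suc b)
      eY≡eU : i + suc a + (suc b + suc c) ≡ i + (suc a + suc b + suc c)
      eY≡eU = trans (+-assoc i (suc a) (suc b + suc c)) (cong (i +_) (sym (+-assoc (suc a) (suc b) (suc c))))

    vB vX vY vU : ℕ × ℕ
    vB = hB , b
    vX = h₁ , a + suc b
    vY = h₂ , b + suc c
    vU = hU , a + suc b + suc c

    private
      ShrinksBetween : ℕ × ℕ → ℕ × ℕ → Set
      ShrinksBetween x y =
        ∀ {j m g} → Block j (suc m) g → x ⊂I (g , m) → (g , m) ⊂I y → SmallerOverlap (a + c)

      via-Block : ∀ {x y} → ShrinksBetween x y → Between x y → SmallerOverlap (a + c)
      via-Block case (_ , vK , x⊂K , K⊂y) = case (proj₂ (IsInterval⇒Block vK)) x⊂K K⊂y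

    below-left : ShrinksBetween vB vX
    below-left {j} {m} K B⊂K K⊂X = shrink-left o K i<j j<i+α (trans eK≡eX (sym eB≡eX))
      where
      B⊑K : j ≤ i + suc a × i + suc a + suc b ≤ j + suc m
      B⊑K = ⊆I⇒positions B K (proj₁ B⊂K)
      K⊑X : i ≤ j × j + suc m ≤ i + (suc a + suc b)
      K⊑X = ⊆I⇒positions K X (proj₁ K⊂X)
      eK≡eX : j + suc m ≡ i + (suc a + suc b)
      eK≡eX = ≤-antisym (proj₂ K⊑X) (subst (_≤ j + suc m) eB≡eX (proj₂ B⊑K))
      i<j : i < j
      i<j = ≤∧≢⇒< (proj₁ K⊑X)
        (λ i≡j → proj₂ K⊂X (same-positions⇒same-interval K X (sym i≡j) eK≡eX))
      j<i+α : j < i + suc a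
      j<i+α = ≤∧≢⇒< (proj₁ B⊑K)
        (λ j≡i+α → proj₂ B⊂K (sym (same-positions⇒same-interval K B j≡i+α (trans eK≡eX (sym eB≡eX)))))

    below-right : ShrinksBetween vB vY
    below-right {j} {m} {g} K B⊂K K⊂Y =
      shrink-right o (subst (λ p → Block p (suc m) g) j≡i+α K)
        (+-cancelˡ-< (i + suc a) _ _ (subst (λ p → i + suc a + suc b < p + suc m) j≡i+α eB<eK))
        (+-cancelˡ-< (i + suc a) _ _ (subst (λ p → p + suc m < i + suc a + (suc b + suc c)) j≡i+α eK<eY))
      where
      B⊑K : j ≤ i + suc a × i + suc a + suc b ≤ j + suc m
      B⊑K = ⊆I⇒positions B K (proj₁ B⊂K)
      K⊑Y : i + suc a ≤ j × j + suc m ≤ i + suc a + (suc b + suc c)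
      K⊑Y = ⊆I⇒positions K Y (proj₁ K⊂Y)
      j≡i+α : j ≡ i + suc a
      j≡i+α = ≤-antisym (proj₁ B⊑K) (proj₁ K⊑Y)
      eB<eK : i + suc a + suc b < j + suc m
      eB<eK = ≤∧≢⇒< (proj₂ B⊑K)
        (λ e → proj₂ B⊂K (sym (same-positions⇒same-interval K B j≡i+α (sym e))))
      eK<eY : j + suc m < i + suc a + (suc b + suc c)
      eK<eY = ≤∧≢⇒< (proj₂ K⊑Y) (λ e → proj₂ K⊂Y (same-positions⇒same-interval K Y j≡i+α e))

    above-left : ShrinksBetween vX vU
    above-left {j} {m} {g} K X⊂K K⊂U =
      let b′ , eBC≡eK , _ , BC = K∩Y in
      shrink-right o BC
        (+-cancelˡ-< (i + suc a) _ _
          (subst (i + suc a + suc b <_) (sym eBC≡eK) (<-≤-trans (s≤s (≤-reflexive eB≡eX)) eX<eK)))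
        (+-cancelˡ-< (i + suc a) _ _
          (subst (_< i + suc a + (suc b + suc c)) (sym eBC≡eK) (subst (i + suc m <_) (sym eY≡eU) eK<eU)))
      where
      X⊑K : j ≤ i × i + (suc a + suc b) ≤ j + suc m
      X⊑K = ⊆I⇒positions X K (proj₁ X⊂K)
      K⊑U : i ≤ j × j + suc m ≤ i + (suc a + suc b + suc c)
      K⊑U = ⊆I⇒positions K U (proj₁ K⊂U)
      j≡i : j ≡ i
      j≡i = ≤-antisym (proj₁ X⊑K) (proj₁ K⊑U)
      eX<eK : i + (suc a + suc b) < i + suc m
      eX<eK = subst (λ p → i + (suc a + suc b) < p + suc m) j≡i
        (≤∧≢⇒< (proj₂ X⊑K) (λ e → proj₂ X⊂K (sym (same-positions⇒same-interval K X j≡i (sym e)))))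
      eK<eU : i + suc m < i + (suc a + suc b + suc c)
      eK<eU = subst (λ p → p + suc m < i + (suc a + suc b + suc c)) j≡i
        (≤∧≢⇒< (proj₂ K⊑U) (λ e → proj₂ K⊂U (same-positions⇒same-interval K U j≡i e)))
      K∩Y : Σ ℕ λ b′ → i + suc a + suc b′ ≡ i + suc m × ∃ λ h → Block (i + suc a) (suc b′) h
      K∩Y = overlapping-∩ (subst (λ p → Block p (suc m) g) j≡i K) Y (m<m+n i z<s)
              (≤-<-trans (+-monoʳ-≤ i (m≤m+n (suc a) (suc b))) eX<eK) (subst (i + suc m <_) (sym eY≡eU) eK<eU)

    above-right : ShrinksBetween vY vU
    above-right {j} {m} K Y⊂K K⊂U =
      let _ , eBK≡eX , _ , BK = X∩K in shrink-left o BK i<j j<i+α (trans eBK≡eX (sym eB≡eX))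
      where
      Y⊑K : j ≤ i + suc a × i + suc a + (suc b + suc c) ≤ j + suc m
      Y⊑K = ⊆I⇒positions Y K (proj₁ Y⊂K)
      K⊑U : i ≤ j × j + suc m ≤ i + (suc a + suc b + suc c)
      K⊑U = ⊆I⇒positions K U (proj₁ K⊂U)
      eK≡eU : j + suc m ≡ i + (suc a + suc b + suc c)
      eK≡eU = ≤-antisym (proj₂ K⊑U) (subst (_≤ j + suc m) eY≡eU (proj₂ Y⊑K))
      i<j : i < j
      i<j = ≤∧≢⇒< (proj₁ K⊑U)
        (λ i≡j → proj₂ K⊂U (same-positions⇒same-interval K U (sym i≡j) eK≡eU))
      j<i+α : j < i + suc a
      j<i+α = ≤∧≢⇒< (proj₁ Y⊑K)
        (λ j≡i+α → proj₂ Y⊂K (sym (same-positions⇒same-interval K Y j≡i+α (trans eK≡eU (sym eY≡eU)))))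
      X∩K : Σ ℕ λ b′ → j + suc b′ ≡ i + (suc a + suc b) × ∃ λ h → Block j (suc b′) h
      X∩K = overlapping-∩ X K i<j (<-≤-trans j<i+α (+-monoʳ-≤ i (m≤m+n (suc a) (suc b))))
              (subst (i + (suc a + suc b) <_) (sym eK≡eU) (+-monoʳ-< i (m<m+n (suc a + suc b) z<s)))

    private
      rank≢ : ∀ {x y : ℕ × ℕ} → proj₂ x < proj₂ y → x ≢ y
      rank≢ lt x≡y = <-irrefl (cong proj₂ x≡y) lt

      b<rX : b < a + suc b
      b<rX = subst (b <_) (sym (+-suc a b)) (s≤s (m≤n+m b a))
      b<rY : b < b + suc c
      b<rY = m<m+n b z<s
      rX<rU : a + suc b < a + suc b + suc c
      rX<rU = m<m+n (a + suc b) z<s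
      rY<rU : b + suc c < a + suc b + suc c
      rY<rU = subst (b + suc c <_) (trans (sym (+-suc a (b + suc c))) (sym (+-assoc a (suc b) (suc c))))
                (s≤s (m≤n+m (b + suc c) a))

      X≢Y : vX ≢ vY
      X≢Y vX≡vY = <-irrefl
        (Block-positions-unique X (subst (λ v → Block (i + suc a) (suc (proj₂ v)) (proj₁ v)) (sym vX≡vY) Y))
        (m<m+n i z<s)

      B⊂X : vB ⊂I vX
      B⊂X = positions⇒⊆I B X (m≤m+n i (suc a)) (≤-reflexive eB≡eX) , rank≢ b<rX
      B⊂Y : vB ⊂I vY
      B⊂Y = positions⇒⊆I B Y ≤-refl (+-monoʳ-≤ (i + suc a) (m≤m+n (suc b) (suc c))) , rank≢ b<rY
      X⊂U : vX ⊂I vU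
      X⊂U = positions⇒⊆I X U ≤-refl (+-monoʳ-≤ i (m≤m+n (suc a + suc b) (suc c))) , rank≢ rX<rU
      Y⊂U : vY ⊂I vU
      Y⊂U = positions⇒⊆I Y U (m≤m+n i (suc a)) (≤-reflexive eY≡eU) , rank≢ rY<rU

    square-not-acyclic : ¬ Between vB vX → ¬ Between vB vY → ¬ Between vX vU → ¬ Between vY vU →
                         ¬ Acyclic (IsInterval w) Edge
    square-not-acyclic ∄₁ ∄₂ ∄₃ ∄₄ acyclic = acyclic
      (vB , vX , vU , vY ∷ [] ,
       vB∈ ∷ vX∈ ∷ vU∈ ∷ vY∈ ∷ [] ,
       (proj₂ B⊂X ∷ rank≢ (<-trans b<rX rX<rU) ∷ proj₂ B⊂Y ∷ []) ∷
         (proj₂ X⊂U ∷ X≢Y ∷ []) ∷ ((proj₂ Y⊂U ∘ sym) ∷ []) ∷ [] ∷ [] ,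
       ((vB∈ , vX∈ , inj₁ (B⊂X , ∄₁)) , (vX∈ , vU∈ , inj₁ (X⊂U , ∄₃)) ,
         (vU∈ , vY∈ , inj₂ (Y⊂U , ∄₄)) , tt) ,
       (vY∈ , vB∈ , inj₂ (B⊂Y , ∄₂)))
      where
      vB∈ : IsInterval w vB
      vB∈ = Block⇒IsInterval B
      vX∈ : IsInterval w vX
      vX∈ = Block⇒IsInterval X
      vY∈ : IsInterval w vY
      vY∈ = Block⇒IsInterval Y
      vU∈ : IsInterval w vU
      vU∈ = Block⇒IsInterval U

    smaller-overlap : Acyclic (IsInterval w) Edge → SmallerOverlap (a + c)
    smaller-overlap acyclic =
      Sum.[ via-Block below-left  , (λ ∄₁ →
      Sum.[ via-Block below-right , (λ ∄₂ →
      Sum.[ via-Block above-left  , (λ ∄₃ →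
      Sum.[ via-Block above-right , (λ ∄₄ → ⊥-elim (square-not-acyclic ∄₁ ∄₂ ∄₃ ∄₄ acyclic))
          ]′ (toSum (Between? vY vU)))
          ]′ (toSum (Between? vX vU)))
          ]′ (toSum (Between? vB vY)))
          ]′ (toSum (Between? vB vX))

  acyclic⇒no-overlap : Acyclic (IsInterval w) Edge → ∀ {i a b c} → Overlap i a b c → ⊥
  acyclic⇒no-overlap acyclic = go (<-wellFounded _)
    where
    go : ∀ {i a b c} → Acc _<_ (a + c) → Overlap i a b c → ⊥
    go (acc smaller) o = let _ , _ , _ , _ , o′ , lt = Square.smaller-overlap o acyclic in go (smaller lt) o′

  tree⇒pattern-free : HasseIsTree w → ¬ Pattern
  tree⇒pattern-free (_ , acyclic) occurs =
    let _ , _ , _ , _ , sum = Pattern⇒BlockSum occurs in acyclic⇒no-overlap acyclic (BlockSum⇒Overlap sum)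

theorem6p1 : (n : ℕ) (w : Permutation′ n) →
    HasseIsTree w ⇔
      (¬ (Σ (ℕ × ℕ) λ I → IsInterval w I ×
            (Σ ℕ λ a → Σ ℕ λ b → Σ ℕ λ c →
             Σ (Permutation′ (suc a)) λ p₁ →
             Σ (Permutation′ (suc b)) λ p₂ →
             Σ (Permutation′ (suc c)) λ p₃ →
               OrderIso (subword w I) (oneLine p₁ ⊕ oneLine p₂ ⊕ oneLine p₃)
             ⊎ OrderIso (subword w I) (oneLine p₁ ⊖ oneLine p₂ ⊖ oneLine p₃))))
theorem6p1 n w = mk⇔ tree⇒pattern-free pattern-free⇒tree
  where open Intervals w
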